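{- Let $p$ be an odd prime, $N_{p-2}$ the number of permutations of $p-2$ letters with an even number of ascents, and $H'_{p-1}=1+\frac13+\dots+\frac1{p-2}$. Then the following are equivalent: (a) $p$ is a Wieferich prime; (b) $(2N_{p-2})_0=1$; (c) $(H'_{p-1})_0=0$.
   Context: A prime $p$ is a Wieferich prime if $q_p(2)=\frac{2^{p-1}-1}{p}\equiv0\pmod p$. For a $p$-adic integer $x$, $(x)_0\in\{0,\dots,p-1\}$ denotes its residue modulo $p$. For a permutation $(i_1,\dots,i_n)$ of $\{1,\dots,n\}$, an ascent is an index $k$ with $i_{k+1}>i_k$. -}

module Defs where

open import Data.Nat using (ℕ; zero; suc; _+_; _*_; _∸_; _^_; _<ᵇ_; _%_; _/_; NonZero)
import Data.Nat.Properties as ℕP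
open import Data.Nat.Divisibility using (_∣_)
open import Data.Bool using (if_then_else_)
open import Data.List using (List; []; _∷_; map; concatMap; filter; length; upTo)
open import Data.List.Relation.Unary.Unique.DecPropositional ℕP._≟_ using (unique?)
open import Data.Integer as ℤ using (ℤ; +_)
open import Data.Rational as ℚ using (ℚ; ↥_)
open import Relation.Binary.PropositionalEquality using (_≡_)

Wieferich : (p : ℕ) → .{{NonZero p}} → Set
Wieferich p = p ∣ ((2 ^ (p ∸ 1) ∸ 1) / p)

letters : ℕ → List ℕ
letters n = map suc (upTo n)

words : ℕ → ℕ → List (List ℕ)
words n zero    = [] ∷ []
words n (suc k) = concatMap (λ w → map (_∷ w) (letters n)) (words n k)

permutations : ℕ → List (List ℕ)
permutations n = filter unique? (words n n)

ascents : List ℕ → ℕ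
ascents (x ∷ y ∷ r) = (if x <ᵇ y then 1 else 0) + ascents (y ∷ r)
ascents _           = 0

N : ℕ → ℕ
N n = length (filter (λ w → ascents w % 2 ℕP.≟ 0) (permutations n))

oddHarmonic : ℕ → ℚ
oddHarmonic zero    = ℚ.0ℚ
oddHarmonic (suc m) = oddHarmonic m ℚ.+ (+ 1 ℚ./ suc (2 * m))

-- H'_{p-1} = 1 + 1/3 + … + 1/(p-2)  (the (p-1)/2 odd reciprocals below p)
H′ : ℕ → ℚ
H′ p = oddHarmonic ((p ∸ 1) / 2)

-- (x)_0 = 0 for a p-adic integer x ∈ ℚ (denominator prime to p):
-- p divides the numerator of x in lowest terms.
ResidueZero : ℕ → ℚ → Set
ResidueZero p x = p ∣ ℤ.∣ ↥ x ∣

-- Write p = 2m+1 and read fractions modulo p, where 1/i ≡ i^(p−2), and let H = 1 + 1/3 + ⋯ + 1/(p−2).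
-- Each of the three conditions is equivalent to H ≡ 0 (mod p).
-- (a) 2^p − 2 = Σ_{0<k<p} C(p,k) and C(p,k)/p ≡ (−1)^(k−1)/k, so 2·q_p(2) ≡ Σ_{0<k<p} (−1)^(k−1)/k;
--     the reflection k ↦ p − k turns the even terms into a second copy of H, hence q_p(2) ≡ H.
-- (b) N_{p−2} is the sum of the Eulerian numbers A(p−2, 2t), since counting permutations by ascents satisfies
--     the Eulerian recurrence (insert the largest letter).  Modulo p, Worpitzky's identity
--     (j+1)^n = Σ_k C(n+j−k, n)·A(n,k) at n = p−2 collapses to A(p−2, j) ≡ 1 + 1/2 + ⋯ + 1/(j+1);
--     summing over even j and reflecting once more gives 2·N_{p−2} ≡ 1 + H.
-- (c) H′ = S/D with D = 1·3⋯(p−2) prime to p and S ≡ D·H, so p divides the reduced numerator of H′ iff H ≡ 0.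
module Submission where

open import Data.Nat as ℕ using (ℕ; zero; suc)
open import Data.Integer as ℤ using (ℤ)
import Algebra
import Data.Nat.Properties
import Data.Integer.Properties
import Data.Nat.Primality
import Defs

double : ℕ → ℕ
double zero    = zero
double (suc n) = suc (suc (double n))


module DoubleProperties where

  open import Data.Nat
  open import Data.Nat.Properties
  open import Relation.Binary.PropositionalEquality

  double≡2* : ∀ n → double n ≡ 2 * n
  double≡2* zero    = refl
  double≡2* (suc n) = cong suc (trans (cong suc (double≡2* n)) (sym (+-suc n (n + 0))))

  double-mono-≤ : ∀ {m n} → m ≤ n → double m ≤ double n
  double-mono-≤ z≤n       = z≤n
  double-mono-≤ (s≤s m≤n) = s≤s (s≤s (double-mono-≤ m≤n))

  double-mono-< : ∀ {m n} → m < n → double m < double n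
  double-mono-< (s≤s m≤n) = s≤s (≤-trans (double-mono-≤ m≤n) (n≤1+n _))

  double%2≡0 : ∀ n → double n % 2 ≡ 0
  double%2≡0 zero    = refl
  double%2≡0 (suc n) = double%2≡0 n

  suc-double%2≡1 : ∀ n → suc (double n) % 2 ≡ 1
  suc-double%2≡1 zero    = refl
  suc-double%2≡1 (suc n) = suc-double%2≡1 n

  double[n]/2≡n : ∀ n → double n / 2 ≡ n
  double[n]/2≡n n = trans (cong (_/ 2) (trans (double≡2* n) (*-comm 2 n))) (m*n/n≡m n 2)
    where open import Data.Nat.DivMod using (m*n/n≡m)

  double-reflect : ∀ {m s} → s < m → suc (suc (double (m ∸ suc s))) ≡ suc (double m) ∸ suc (double s)
  double-reflect {suc m} {zero}  _         = refl
  double-reflect {suc m} {suc s} (s≤s s<m) = double-reflect s<m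


module Sum {c ℓ} (S : Algebra.CommutativeSemiring c ℓ) where

  open import Data.Nat using (_<_; _∸_)
  open import Data.Nat.Properties using (m<n⇒m<1+n; n<1+n)
  open Algebra.CommutativeSemiring S
  open import Algebra.Properties.CommutativeSemigroup +-commutativeSemigroup using (interchange)

  Σ< : ℕ → (ℕ → Carrier) → Carrier
  Σ< zero    f = 0#
  Σ< (suc n) f = Σ< n f + f n

  Σ<-cong : ∀ n {f g} → (∀ i → i < n → f i ≈ g i) → Σ< n f ≈ Σ< n g
  Σ<-cong zero    f≈g = refl
  Σ<-cong (suc n) f≈g = +-cong (Σ<-cong n (λ i i<n → f≈g i (m<n⇒m<1+n i<n))) (f≈g n (n<1+n n))

  Σ<-zero : ∀ n {f} → (∀ i → i < n → f i ≈ 0#) → Σ< n f ≈ 0#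
  Σ<-zero zero    f≈0 = refl
  Σ<-zero (suc n) f≈0 =
    trans (+-cong (Σ<-zero n (λ i i<n → f≈0 i (m<n⇒m<1+n i<n))) (f≈0 n (n<1+n n))) (+-identityˡ 0#)

  Σ<-+ : ∀ n f g → Σ< n (λ i → f i + g i) ≈ Σ< n f + Σ< n g
  Σ<-+ zero    f g = sym (+-identityˡ 0#)
  Σ<-+ (suc n) f g = trans (+-congʳ (Σ<-+ n f g)) (interchange _ _ _ _)

  Σ<-*ˡ : ∀ n a f → Σ< n (λ i → a * f i) ≈ a * Σ< n f
  Σ<-*ˡ zero    a f = sym (zeroʳ a)
  Σ<-*ˡ (suc n) a f = trans (+-congʳ (Σ<-*ˡ n a f)) (sym (distribˡ a _ _))

  Σ<-*ʳ : ∀ n a f → Σ< n (λ i → f i * a) ≈ Σ< n f * a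
  Σ<-*ʳ zero    a f = sym (zeroˡ a)
  Σ<-*ʳ (suc n) a f = trans (+-congʳ (Σ<-*ʳ n a f)) (sym (distribʳ a _ _))

  Σ<-shift : ∀ n f → Σ< (suc n) f ≈ f 0 + Σ< n (λ i → f (suc i))
  Σ<-shift zero    f = +-comm 0# (f 0)
  Σ<-shift (suc n) f = trans (+-congʳ (Σ<-shift n f)) (+-assoc _ _ _)

  Σ<-reverse : ∀ n f → Σ< n f ≈ Σ< n (λ i → f (n ∸ suc i))
  Σ<-reverse zero    f = refl
  Σ<-reverse (suc n) f =
    trans (+-congʳ (Σ<-reverse n f)) (trans (+-comm _ (f n)) (sym (Σ<-shift n _)))

  Σ<-double : ∀ m f → Σ< (double m) f ≈ Σ< m (λ s → f (double s)) + Σ< m (λ s → f (suc (double s)))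
  Σ<-double zero    f = sym (+-identityˡ 0#)
  Σ<-double (suc m) f =
    trans (+-congʳ (+-congʳ (Σ<-double m f))) (trans (+-assoc _ _ _) (interchange _ _ _ _))

module ℕΣ = Sum Data.Nat.Properties.+-*-commutativeSemiring
module ℤΣ = Sum Data.Integer.Properties.+-*-commutativeSemiring


module Congruence (m : ℤ) where

  open import Data.Nat using (_<_)
  open import Data.Nat.Properties using (m<n⇒m<1+n; n<1+n)
  open import Data.Integer using (+_; -_; ∣_∣; _+_; _*_; _-_; +0; _^_)
  open import Data.Nat.Divisibility renaming (_∣_ to _ℕ∣_) using ()
  open import Data.Integer.Divisibility.Signed using (divides; ∣ᵤ⇒∣; ∣⇒∣ᵤ)
  open import Data.Integer.Properties using (+-identityˡ)
  open import Data.Integer.Tactic.RingSolver using (solve)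
  open import Data.List using ([]; _∷_)
  open import Relation.Binary.Bundles using (Setoid)
  import Relation.Binary.Reasoning.Setoid
  open import Relation.Binary.PropositionalEquality hiding (setoid)
  open ℤΣ using (Σ<)

  infix 4 _≈_
  infixr 4 _,_
  record _≈_ (a b : ℤ) : Set where
    constructor _,_
    field
      quotient : ℤ
      equation : a ≡ b + quotient * m

  ≈-refl : ∀ {a} → a ≈ a
  ≈-refl {a} = +0 , solve (a ∷ m ∷ [])

  ≈-reflexive : ∀ {a b} → a ≡ b → a ≈ b
  ≈-reflexive refl = ≈-refl

  ≈-sym : ∀ {a b} → a ≈ b → b ≈ a
  ≈-sym {b = b} (k , refl) = - k , solve (b ∷ k ∷ m ∷ [])

  ≈-trans : ∀ {a b c} → a ≈ b → b ≈ c → a ≈ c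
  ≈-trans {c = c} (k , refl) (l , refl) = l + k , solve (c ∷ k ∷ l ∷ m ∷ [])

  setoid : Setoid _ _
  setoid = record
    { Carrier = ℤ ; _≈_ = _≈_
    ; isEquivalence = record { refl = ≈-refl ; sym = ≈-sym ; trans = ≈-trans } }

  module ≈-Reasoning = Relation.Binary.Reasoning.Setoid setoid

  +-cong : ∀ {a b c d} → a ≈ b → c ≈ d → a + c ≈ b + d
  +-cong {b = b} {d = d} (k , refl) (l , refl) = k + l , solve (b ∷ d ∷ k ∷ l ∷ m ∷ [])

  *-cong : ∀ {a b c d} → a ≈ b → c ≈ d → a * c ≈ b * d
  *-cong {b = b} {d = d} (k , refl) (l , refl) =
    k * d + b * l + k * l * m , solve (b ∷ d ∷ k ∷ l ∷ m ∷ [])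

  -‿cong : ∀ {a b} → a ≈ b → - a ≈ - b
  -‿cong {b = b} (k , refl) = - k , solve (b ∷ k ∷ m ∷ [])

  ^-cong : ∀ {a b} n → a ≈ b → a ^ n ≈ b ^ n
  ^-cong zero    a≈b = ≈-refl
  ^-cong (suc n) a≈b = *-cong a≈b (^-cong n a≈b)

  Σ<-cong : ∀ n {f g} → (∀ i → i < n → f i ≈ g i) → Σ< n f ≈ Σ< n g
  Σ<-cong zero    f≈g = ≈-refl
  Σ<-cong (suc n) f≈g = +-cong (Σ<-cong n (λ i i<n → f≈g i (m<n⇒m<1+n i<n))) (f≈g n (n<1+n n))

  m≈0 : m ≈ +0
  m≈0 = + 1 , solve (m ∷ [])

  ∣⇒≈0 : ∀ {a} → ∣ m ∣ ℕ∣ ∣ a ∣ → a ≈ +0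
  ∣⇒≈0 {a} m∣a with ∣ᵤ⇒∣ {m} {a} m∣a
  ... | divides k refl = k , solve (k ∷ m ∷ [])

  ≈0⇒∣ : ∀ {a} → a ≈ +0 → ∣ m ∣ ℕ∣ ∣ a ∣
  ≈0⇒∣ (k , refl) = ∣⇒∣ᵤ {m} (divides k (+-identityˡ (k * m)))

  x-y≈0⇒x≈y : ∀ {a b} → a - b ≈ +0 → a ≈ b
  x-y≈0⇒x≈y {a} {b} (k , a-b≡km) = k , (begin
    a                   ≡⟨ solve (a ∷ b ∷ []) ⟩
    b + (a - b)         ≡⟨ cong (λ x → b + x) a-b≡km ⟩
    b + (+0 + k * m)    ≡⟨ solve (b ∷ k ∷ m ∷ []) ⟩
    b + k * m           ∎)
    where open ≡-Reasoning

  x≈y⇒x-y≈0 : ∀ {a b} → a ≈ b → a - b ≈ +0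
  x≈y⇒x-y≈0 {b = b} (k , refl) = k , solve (b ∷ k ∷ m ∷ [])

  +-cancelˡ-≈ : ∀ {a b c} → a + b ≈ a + c → b ≈ c
  +-cancelˡ-≈ {a} {b} {c} a+b≈a+c = x-y≈0⇒x≈y (subst (_≈ +0) cancel (x≈y⇒x-y≈0 a+b≈a+c))
    where
      cancel : (a + b) - (a + c) ≡ b - c
      cancel = solve (a ∷ b ∷ c ∷ [])

  x+y≈0⇒y≈-x : ∀ {a b} → a + b ≈ +0 → b ≈ - a
  x+y≈0⇒y≈-x {a} {b} (k , a+b≡km) = k , (begin
    b                   ≡⟨ solve (a ∷ b ∷ []) ⟩
    - a + (a + b)       ≡⟨ cong (λ x → - a + x) a+b≡km ⟩
    - a + (+0 + k * m)  ≡⟨ solve (a ∷ k ∷ m ∷ []) ⟩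
    - a + k * m         ∎)
    where open ≡-Reasoning


-- Pascal's rule is taken as the definition (rather than Data.Nat.Combinatorics._C_),
-- so that the recurrences below hold by computation.
module Binomial where

  open import Data.Nat
  open import Data.Nat.Properties
  open import Data.Nat.Tactic.RingSolver using (solve)
  open import Data.List using ([]; _∷_)
  open import Relation.Binary.PropositionalEquality
  open ≡-Reasoning
  open ℕΣ

  binomial : ℕ → ℕ → ℕ
  binomial n       zero    = 1
  binomial zero    (suc k) = 0
  binomial (suc n) (suc k) = binomial n k + binomial n (suc k)

  binomial-≡0 : ∀ {n k} → n < k → binomial n k ≡ 0
  binomial-≡0 {zero}  {suc k} _         = refl
  binomial-≡0 {suc n} {suc k} (s≤s n<k) =
    cong₂ _+_ (binomial-≡0 n<k) (binomial-≡0 (m<n⇒m<1+n n<k))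

  binomial-diag : ∀ n → binomial n n ≡ 1
  binomial-diag zero    = refl
  binomial-diag (suc n) = cong₂ _+_ (binomial-diag n) (binomial-≡0 (n<1+n n))

  binomial-1 : ∀ n → binomial n 1 ≡ n
  binomial-1 zero    = refl
  binomial-1 (suc n) = cong suc (binomial-1 n)

  binomial-sym : ∀ m n → binomial (m + n) m ≡ binomial (m + n) n
  binomial-sym zero    zero    = refl
  binomial-sym zero    (suc n) = sym (binomial-diag (suc n))
  binomial-sym (suc m) zero    = trans (cong (λ k → binomial k (suc m)) (+-identityʳ (suc m))) (binomial-diag (suc m))
  binomial-sym (suc m) (suc n) = begin
    binomial (m + suc n) m + binomial (m + suc n) (suc m)
      ≡⟨ cong₂ _+_ (binomial-sym m (suc n)) (cong (λ k → binomial k (suc m)) (+-suc m n)) ⟩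
    binomial (m + suc n) (suc n) + binomial (suc m + n) (suc m)
      ≡⟨ cong (binomial (m + suc n) (suc n) +_) (binomial-sym (suc m) n) ⟩
    binomial (m + suc n) (suc n) + binomial (suc m + n) n
      ≡⟨ cong (λ k → binomial (m + suc n) (suc n) + binomial k n) (sym (+-suc m n)) ⟩
    binomial (m + suc n) (suc n) + binomial (m + suc n) n
      ≡⟨ +-comm (binomial (m + suc n) (suc n)) _ ⟩
    binomial (m + suc n) n + binomial (m + suc n) (suc n) ∎

  binomial-[1+n]n : ∀ n → binomial (suc n) n ≡ suc n
  binomial-[1+n]n n = begin
    binomial (suc n) n    ≡⟨ cong (λ k → binomial k n) (+-comm 1 n) ⟩
    binomial (n + 1) n    ≡⟨ binomial-sym n 1 ⟩
    binomial (n + 1) 1    ≡⟨ binomial-1 (n + 1) ⟩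
    n + 1                 ≡⟨ +-comm n 1 ⟩
    suc n                 ∎

  -- The ratio of consecutive binomial coefficients, (k+1)·C(n,k+1) = (n−k)·C(n,k), without subtraction.
  binomial-ratio : ∀ n k → suc k * binomial n (suc k) + k * binomial n k ≡ n * binomial n k
  binomial-ratio zero    zero    = refl
  binomial-ratio zero    (suc k) = cong₂ _+_ (*-zeroʳ (suc (suc k))) (*-zeroʳ (suc k))
  binomial-ratio (suc n) zero    rewrite binomial-1 n = solve (n ∷ [])
  binomial-ratio (suc n) (suc k) =
    step (binomial n k) (binomial n (suc k)) (binomial n (suc (suc k)))
         (binomial-ratio n (suc k)) (binomial-ratio n k)
    where
      step : ∀ a b c → suc (suc k) * c + suc k * b ≡ n * b → suc k * b + k * a ≡ n * a →
             suc (suc k) * (b + c) + suc k * (a + b) ≡ suc n * (a + b)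
      step a b c hb ha = begin
        suc (suc k) * (b + c) + suc k * (a + b)
          ≡⟨ solve (a ∷ b ∷ c ∷ k ∷ []) ⟩
        (suc (suc k) * c + suc k * b) + (suc (suc k) * b + suc k * a)
          ≡⟨ cong (_+ (suc (suc k) * b + suc k * a)) hb ⟩
        n * b + (suc (suc k) * b + suc k * a)
          ≡⟨ solve (a ∷ b ∷ k ∷ n ∷ []) ⟩
        (n * b + b + a) + (suc k * b + k * a)
          ≡⟨ cong ((n * b + b + a) +_) ha ⟩
        (n * b + b + a) + n * a
          ≡⟨ solve (a ∷ b ∷ n ∷ []) ⟩
        suc n * (a + b) ∎

  binomial-absorption : ∀ n k → suc k * binomial (suc n) (suc k) ≡ suc n * binomial n k
  binomial-absorption n k = step (binomial n k) (binomial n (suc k)) (binomial-ratio n k)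
    where
      step : ∀ a b → suc k * b + k * a ≡ n * a → suc k * (a + b) ≡ suc n * a
      step a b h = +-cancelʳ-≡ (k * a) _ _ (begin
        suc k * (a + b) + k * a         ≡⟨ solve (a ∷ b ∷ k ∷ []) ⟩
        suc k * a + (suc k * b + k * a) ≡⟨ cong (suc k * a +_) h ⟩
        suc k * a + n * a               ≡⟨ solve (a ∷ k ∷ n ∷ []) ⟩
        suc n * a + k * a               ∎)

  binomial-theorem : ∀ a n → suc a ^ n ≡ Σ< (suc n) (λ k → binomial n k * a ^ k)
  binomial-theorem a zero    = refl
  binomial-theorem a (suc n) = begin
    suc a ^ suc n
      ≡⟨ cong (suc a *_) (binomial-theorem a n) ⟩
    S + a * S
      ≡⟨ +-comm S (a * S) ⟩
    a * S + S
      ≡⟨ cong₂ _+_ (sym (Σ<-*ˡ (suc n) a _)) (Σ<-shift n _) ⟩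
    Σ< (suc n) (λ k → a * (binomial n k * a ^ k)) + (1 + Σ< n (λ k → binomial n (suc k) * a ^ suc k))
      ≡⟨ cong₂ (λ x y → x + (1 + y)) (Σ<-cong (suc n) (λ k _ → x∙yz≈y∙xz a (binomial n k) (a ^ k)))
                                      (sym (trans (cong (Σ< n (λ k → binomial n (suc k) * a ^ suc k) +_) last≡0) (+-identityʳ _))) ⟩
    Σ< (suc n) (λ k → binomial n k * a ^ suc k) + (1 + Σ< (suc n) (λ k → binomial n (suc k) * a ^ suc k))
      ≡⟨ +-suc (Σ< (suc n) (λ k → binomial n k * a ^ suc k)) _ ⟩
    1 + (Σ< (suc n) (λ k → binomial n k * a ^ suc k) + Σ< (suc n) (λ k → binomial n (suc k) * a ^ suc k))
      ≡⟨ cong (1 +_) (sym (Σ<-+ (suc n) _ _)) ⟩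
    1 + Σ< (suc n) (λ k → binomial n k * a ^ suc k + binomial n (suc k) * a ^ suc k)
      ≡⟨ cong (1 +_) (Σ<-cong (suc n) (λ k _ → sym (*-distribʳ-+ (a ^ suc k) (binomial n k) _))) ⟩
    1 + Σ< (suc n) (λ k → binomial (suc n) (suc k) * a ^ suc k)
      ≡⟨ Σ<-shift (suc n) _ ⟨
    Σ< (suc (suc n)) (λ k → binomial (suc n) k * a ^ k) ∎
    where
      open import Algebra.Properties.CommutativeSemigroup *-commutativeSemigroup using (x∙yz≈y∙xz)
      S = Σ< (suc n) (λ k → binomial n k * a ^ k)
      last≡0 : binomial n (suc n) * a ^ suc n ≡ 0
      last≡0 = cong (_* a ^ suc n) (binomial-≡0 (n<1+n n))


module SumDivisibility where

  open import Data.Nat using (_<_)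
  open import Data.Nat.Properties using (m<n⇒m<1+n; n<1+n)
  open import Data.Nat.Divisibility using (_∣_; ∣m∣n⇒∣m+n; _∣0)
  open ℕΣ using (Σ<)

  ∣-Σ< : ∀ {d} n f → (∀ i → i < n → d ∣ f i) → d ∣ Σ< n f
  ∣-Σ< zero    f d∣f = _ ∣0
  ∣-Σ< (suc n) f d∣f =
    ∣m∣n⇒∣m+n (∣-Σ< n f (λ i i<n → d∣f i (m<n⇒m<1+n i<n))) (d∣f n (n<1+n n))


module PrimeModulus (n : ℕ) (p-prime : Data.Nat.Primality.Prime (suc n)) where

  open import Data.Nat as ℕ using (_+_; _*_; _^_; _%_; _/_; _<_; z≤n; s≤s; nonTrivial⇒n>1)
  open import Data.Nat.Properties using (<⇒≱; +-assoc; *-identityˡ)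
  open import Data.Nat.DivMod using (m≡m%n+[m/n]*n; m/n*n≡m; [m+kn]%n≡m%n; m<n⇒m%n≡m)
  open import Data.Nat.Primality using (prime⇒nonTrivial)
  open import Function using (_⇔_; mk⇔)
  open import Data.Nat.Divisibility using (_∣_; ∣⇒≤; m∣m*n; ∣m⇒∣m*n)
  open import Data.Nat.Primality using (euclidsLemma)
  open import Data.Integer as ℤ using (+_; +0; ∣_∣; _-_)
  open import Data.Integer.Properties using (abs-*; pos-*; *-identityʳ)
  open import Data.Integer.Tactic.RingSolver using (solve)
  open import Data.List using ([]; _∷_)
  open import Data.Sum using ([_,_]′)
  open import Function using (id)
  open import Relation.Nullary using (¬_; contradiction)
  open import Relation.Binary.PropositionalEquality hiding (setoid)
  open Binomial
  open SumDivisibility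
  open ℕΣ using (Σ<; Σ<-shift)

  p : ℕ
  p = suc n

  open Congruence (+ p) public

  0<k<p⇒p∤k : ∀ {k} → 0 < k → k < p → ¬ p ∣ k
  0<k<p⇒p∤k {suc k} _ k<p p∣k = <⇒≱ k<p (∣⇒≤ p∣k)

  ∣-cancelˡ : ∀ {a b} → ¬ p ∣ a → p ∣ a * b → p ∣ b
  ∣-cancelˡ {a} {b} p∤a p∣ab = [ (λ p∣a → contradiction p∣a p∤a) , id ]′ (euclidsLemma a b p-prime p∣ab)

  *-cancelˡ-≈ : ∀ {a x y} → ¬ p ∣ ∣ a ∣ → a ℤ.* x ≈ a ℤ.* y → x ≈ y
  *-cancelˡ-≈ {a} {x} {y} p∤a ax≈ay = x-y≈0⇒x≈y (∣⇒≈0 (∣-cancelˡ p∤a p∣a[x-y]))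
    where
      factor : a ℤ.* x - a ℤ.* y ≡ a ℤ.* (x - y)
      factor = solve (a ∷ x ∷ y ∷ [])
      p∣a[x-y] : p ∣ ∣ a ∣ * ∣ x - y ∣
      p∣a[x-y] = subst (p ∣_) (abs-* a (x - y))
        (≈0⇒∣ (subst (_≈ +0) factor (x≈y⇒x-y≈0 ax≈ay)))

  p∣binomial : ∀ {k} → 0 < k → k < p → p ∣ binomial p k
  p∣binomial {suc k} _ k<p = ∣-cancelˡ (0<k<p⇒p∤k (s≤s z≤n) k<p)
    (subst (p ∣_) (sym (binomial-absorption n k)) (m∣m*n (binomial n k)))

  ^p-expansion : ∀ a → suc a ^ p ≡ 1 + (Σ< n (λ k → binomial p (suc k) * a ^ suc k) + a ^ p)
  ^p-expansion a = begin
    suc a ^ p                                                 ≡⟨ binomial-theorem a p ⟩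
    Σ< p (λ k → binomial p k * a ^ k) + binomial p p * a ^ p  ≡⟨ cong₂ _+_ (Σ<-shift n _) (cong (_* a ^ p) (binomial-diag p)) ⟩
    1 + middle + 1 * a ^ p                                    ≡⟨ cong (λ x → 1 + middle + x) (*-identityˡ (a ^ p)) ⟩
    1 + middle + a ^ p                                        ≡⟨ +-assoc 1 middle (a ^ p) ⟩
    1 + (middle + a ^ p)                                      ∎
    where
      open ≡-Reasoning
      middle = Σ< n (λ k → binomial p (suc k) * a ^ suc k)

  ^p≈ : ∀ a → + (a ^ p) ≈ + a
  ^p≈ zero    = ≈-refl
  ^p≈ (suc a) = begin
    + (suc a ^ p)                      ≡⟨ cong +_ (^p-expansion a) ⟩
    + 1 ℤ.+ (+ middle ℤ.+ + (a ^ p))   ≈⟨ +-cong (≈-refl {+ 1}) (+-cong (∣⇒≈0 {+ middle} p∣middle) (^p≈ a)) ⟩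
    + 1 ℤ.+ (+0 ℤ.+ + a)               ≡⟨⟩
    + suc a                            ∎
    where
      middle = Σ< n (λ k → binomial p (suc k) * a ^ suc k)
      p∣middle : p ∣ middle
      p∣middle = ∣-Σ< n _ (λ k k<n → ∣m⇒∣m*n (a ^ suc k) (p∣binomial (s≤s z≤n) (s≤s k<n)))
      open ≈-Reasoning

  fermat-little : ∀ {a} → 0 < a → a < p → + (a ^ n) ≈ + 1
  fermat-little {a} 0<a a<p = *-cancelˡ-≈ {+ a} (0<k<p⇒p∤k 0<a a<p) (begin
    + a ℤ.* + (a ^ n)   ≡⟨ pos-* a (a ^ n) ⟨
    + (a ^ p)           ≈⟨ ^p≈ a ⟩
    + a                 ≡⟨ *-identityʳ (+ a) ⟨
    + a ℤ.* + 1         ∎)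
    where open ≈-Reasoning

  1<p : 1 < p
  1<p = nonTrivial⇒n>1 p {{prime⇒nonTrivial p-prime}}

  %≡1⇒≈1 : ∀ x → x % p ≡ 1 → + x ≈ + 1
  %≡1⇒≈1 x x%p≡1 = + (x / p) , (begin
    + x                         ≡⟨ cong +_ (trans (m≡m%n+[m/n]*n x p) (cong (_+ x / p * p) x%p≡1)) ⟩
    + (1 + x / p * p)           ≡⟨ cong (λ y → + 1 ℤ.+ y) (pos-* (x / p) p) ⟩
    + 1 ℤ.+ + (x / p) ℤ.* + p   ∎)
    where open ≡-Reasoning

  ≈1⇒%≡1 : ∀ x → + x ≈ + 1 → x % p ≡ 1
  ≈1⇒%≡1 zero    0≈1 = contradiction (≈0⇒∣ (≈-sym 0≈1)) (0<k<p⇒p∤k (s≤s z≤n) 1<p)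
  ≈1⇒%≡1 (suc x) x+1≈1 = begin
    suc x % p             ≡⟨ cong (λ y → suc y % p) (m/n*n≡m p∣x) ⟨
    (1 + x / p * p) % p   ≡⟨ [m+kn]%n≡m%n 1 (x / p) p ⟩
    1 % p                 ≡⟨ m<n⇒m%n≡m 1<p ⟩
    1                     ∎
    where
      open ≡-Reasoning
      p∣x : p ∣ x
      p∣x = ≈0⇒∣ (+-cancelˡ-≈ {+ 1} {+ x} x+1≈1)

  %≡1⇔≈1 : ∀ x → x % p ≡ 1 ⇔ + x ≈ + 1
  %≡1⇔≈1 x = mk⇔ (%≡1⇒≈1 x) (≈1⇒%≡1 x)


module IntegerFacts where

  import Data.Nat as ℕ
  open import Data.Integer hiding (suc)
  open import Data.Integer.Properties
  open import Data.Integer.Tactic.RingSolver using (solve-∀)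
  open import Relation.Binary.PropositionalEquality

  pos-∸ : ∀ {m n} → n ℕ.≤ m → + (m ℕ.∸ n) ≡ + m - + n
  pos-∸ {m} {n} n≤m = sym (trans (m-n≡m⊖n m n) (⊖-≥ n≤m))

  pos-^ : ∀ a n → + (a ℕ.^ n) ≡ (+ a) ^ n
  pos-^ a zero    = refl
  pos-^ a (suc n) = trans (pos-* a (a ℕ.^ n)) (cong (+ a *_) (pos-^ a n))

  -‿^-odd : ∀ x k → (- x) ^ suc (double k) ≡ - (x ^ suc (double k))
  -‿^-odd x zero    = trans (*-identityʳ (- x)) (cong -_ (sym (*-identityʳ x)))
  -‿^-odd x (suc k) = trans (cong (λ y → - x * (- x * y)) (-‿^-odd x k)) (shuffle x (x ^ suc (double k)))
    where
      shuffle : ∀ x y → - x * (- x * - y) ≡ - (x * (x * y))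
      shuffle = solve-∀

  pos-Σ< : ∀ n f → + ℕΣ.Σ< n f ≡ ℤΣ.Σ< n (λ i → + f i)
  pos-Σ< zero    f = refl
  pos-Σ< (suc n) f = cong (_+ + f n) (pos-Σ< n f)

  alternating : ℕ → ℤ
  alternating zero    = + 1
  alternating (suc k) = - alternating k

  alternating-double : ∀ s → alternating (double s) ≡ + 1
  alternating-double zero    = refl
  alternating-double (suc s) = trans (neg-involutive (alternating (double s))) (alternating-double s)


module OddPrime (m′ : ℕ) (p-prime : Data.Nat.Primality.Prime (suc (double (suc m′)))) where

  open import Data.Nat as ℕ using (_∸_; _^_; _<_; _≤_; s≤s)
  open import Data.Nat.Properties using (<⇒≤)
  open import Data.Integer as ℤ using (+_; -_; +0)
  open import Data.Integer.Properties using (pos-*; +-identityˡ; neg-involutive)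
  open import Relation.Binary.PropositionalEquality hiding (setoid)
  open DoubleProperties
  open IntegerFacts
  open ℤΣ using (Σ<; Σ<-reverse)

  m : ℕ
  m = suc m′

  open PrimeModulus (double m) p-prime public

  inverse : ℕ → ℤ
  inverse i = + (i ^ suc (double m′))

  *-inverse : ∀ {i} → 0 < i → i < p → + i ℤ.* inverse i ≈ + 1
  *-inverse {i} 0<i i<p = subst (_≈ + 1) (pos-* i _) (fermat-little 0<i i<p)

  inverse-reflect : ∀ {i} → i ≤ p → inverse (p ∸ i) ≈ - inverse i
  inverse-reflect {i} i≤p = begin
    + ((p ∸ i) ^ e)      ≡⟨ pos-^ (p ∸ i) e ⟩
    (+ (p ∸ i)) ℤ.^ e    ≈⟨ ^-cong e p-i≈-i ⟩
    (- + i) ℤ.^ e        ≡⟨ -‿^-odd (+ i) m′ ⟩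
    - ((+ i) ℤ.^ e)      ≡⟨ cong -_ (pos-^ i e) ⟨
    - inverse i          ∎
    where
      open ≈-Reasoning
      e = suc (double m′)
      p-i≈-i : + (p ∸ i) ≈ - + i
      p-i≈-i = begin
        + (p ∸ i)          ≡⟨ pos-∸ i≤p ⟩
        + p ℤ.- + i        ≈⟨ +-cong m≈0 (≈-refl { - + i}) ⟩
        +0 ℤ.+ - + i       ≡⟨ +-identityˡ (- + i) ⟩
        - + i              ∎

  H : ℤ
  H = Σ< m (λ s → inverse (suc (double s)))

  -- −1/(2s+2) ≡ 1/(p − 2s − 2), and p − 2s − 2 runs over the odd numbers below p.
  Σ-neg-even-inverse≈H : Σ< m (λ s → - inverse (suc (suc (double s)))) ≈ H
  Σ-neg-even-inverse≈H = begin
    Σ< m (λ s → - inverse (suc (suc (double s))))                 ≡⟨ Σ<-reverse m _ ⟩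
    Σ< m (λ s → - inverse (suc (suc (double (m ∸ suc s)))))       ≡⟨ ℤΣ.Σ<-cong m (λ s s<m → cong (λ i → - inverse i) (double-reflect s<m)) ⟩
    Σ< m (λ s → - inverse (p ∸ suc (double s)))                   ≈⟨ Σ<-cong m (λ s s<m → -‿cong (inverse-reflect (s≤s (double-mono-≤ (<⇒≤ s<m))))) ⟩
    Σ< m (λ s → - - inverse (suc (double s)))                     ≡⟨ ℤΣ.Σ<-cong m (λ s _ → neg-involutive _) ⟩
    H                                                             ∎
    where open ≈-Reasoning


module FermatQuotient (m′ : ℕ) (p-prime : Data.Nat.Primality.Prime (suc (double (suc m′)))) where

  open import Data.Nat as ℕ using (_+_; _*_; _∸_; _^_; _/_; _<_; _≤_; z≤n; s≤s)
  open import Data.Nat.Properties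
    using (≤-trans; n≤1+n; <⇒≤; *-comm; *-identityʳ; *-identityˡ; ^-zeroˡ; m^n>0; m∸n+n≡m; *-cancelˡ-≡; *-cancelʳ-≡; +-cancelˡ-≡; +-cancelʳ-≡)
  open import Data.Nat.DivMod using (m/n*n≡m)
  open import Data.Nat.Divisibility using (_∣_)
  open import Data.Nat.Tactic.RingSolver using (solve-∀)
  open import Data.Integer as ℤ using (+_; -_; +0)
  import Data.Integer.Properties as ℤP
  import Data.Integer.Tactic.RingSolver as ℤSolver
  open import Relation.Binary.PropositionalEquality hiding (setoid)
  open Binomial
  open IntegerFacts
  open OddPrime m′ p-prime
  open ℕΣ using (Σ<-shift; Σ<-*ʳ) renaming (Σ< to ℕΣ<)
  open ℤΣ using (Σ<; Σ<-double)

  binomial-alternating : ∀ {k} → k ≤ double m → + binomial (double m) k ≈ alternating k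
  binomial-alternating {zero}  _     = ≈-refl
  binomial-alternating {suc k} k<2m =
    ≈-trans (x+y≈0⇒y≈-x (∣⇒≈0 (p∣binomial (s≤s z≤n) (s≤s k<2m))))
            (-‿cong (binomial-alternating (≤-trans (n≤1+n k) k<2m)))

  -- C(p, k+1)/p, an integer for k < p − 1.
  binomial/p : ℕ → ℕ
  binomial/p k = binomial p (suc k) / p

  binomial/p*p : ∀ {k} → k < double m → binomial/p k * p ≡ binomial p (suc k)
  binomial/p*p k<2m = m/n*n≡m (p∣binomial (s≤s z≤n) (s≤s k<2m))

  [1+k]*binomial/p : ∀ {k} → k < double m → suc k * binomial/p k ≡ binomial (double m) k
  [1+k]*binomial/p {k} k<2m = *-cancelˡ-≡ _ _ p (begin
    p * (suc k * binomial/p k)   ≡⟨ shuffle p (suc k) (binomial/p k) ⟩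
    suc k * (binomial/p k * p)   ≡⟨ cong (suc k *_) (binomial/p*p k<2m) ⟩
    suc k * binomial p (suc k)   ≡⟨ binomial-absorption (double m) k ⟩
    p * binomial (double m) k    ∎)
    where
      open ≡-Reasoning
      shuffle : ∀ a b c → a * (b * c) ≡ b * (c * a)
      shuffle = solve-∀

  binomial/p≈ : ∀ {k} → k < double m → + binomial/p k ≈ alternating k ℤ.* inverse (suc k)
  binomial/p≈ {k} k<2m = begin
    + binomial/p k                                      ≡⟨ ℤP.*-identityˡ _ ⟨
    + 1 ℤ.* + binomial/p k                              ≈⟨ *-cong (≈-sym (*-inverse (s≤s z≤n) (s≤s k<2m))) (≈-refl {+ binomial/p k}) ⟩
    + suc k ℤ.* inverse (suc k) ℤ.* + binomial/p k      ≡⟨ shuffle (+ suc k) (inverse (suc k)) (+ binomial/p k) ⟩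
    inverse (suc k) ℤ.* (+ suc k ℤ.* + binomial/p k)
      ≡⟨ cong (λ x → inverse (suc k) ℤ.* x) (trans (sym (ℤP.pos-* (suc k) _)) (cong +_ ([1+k]*binomial/p k<2m))) ⟩
    inverse (suc k) ℤ.* + binomial (double m) k         ≈⟨ *-cong (≈-refl {inverse (suc k)}) (binomial-alternating (<⇒≤ k<2m)) ⟩
    inverse (suc k) ℤ.* alternating k                   ≡⟨ ℤP.*-comm (inverse (suc k)) _ ⟩
    alternating k ℤ.* inverse (suc k)                   ∎
    where
      open ≈-Reasoning
      shuffle : ∀ a b c → a ℤ.* b ℤ.* c ≡ b ℤ.* (a ℤ.* c)
      shuffle = ℤSolver.solve-∀

  2^p≡ : 2 ^ p ≡ 1 + ℕΣ< (double m) (λ k → binomial/p k * p) + 1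
  2^p≡ = begin
    2 ^ p                                                     ≡⟨ binomial-theorem 1 p ⟩
    ℕΣ< p (λ k → binomial p k * 1 ^ k) + binomial p p * 1 ^ p ≡⟨ cong₂ _+_ (Σ<-shift (double m) _) (cong₂ _*_ (binomial-diag p) (^-zeroˡ p)) ⟩
    1 + ℕΣ< (double m) (λ k → binomial p (suc k) * 1 ^ suc k) + 1
      ≡⟨ cong (λ x → 1 + x + 1) (ℕΣ.Σ<-cong (double m) (λ k k<2m → begin
           binomial p (suc k) * 1 ^ suc k     ≡⟨ cong (binomial p (suc k) *_) (^-zeroˡ (suc k)) ⟩
           binomial p (suc k) * 1             ≡⟨ *-identityʳ _ ⟩
           binomial p (suc k)                 ≡⟨ binomial/p*p k<2m ⟨
           binomial/p k * p                   ∎)) ⟩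
    1 + ℕΣ< (double m) (λ k → binomial/p k * p) + 1           ∎
    where open ≡-Reasoning

  q : ℕ
  q = (2 ^ double m ∸ 1) / p

  p∣2^[p-1]-1 : p ∣ 2 ^ double m ∸ 1
  p∣2^[p-1]-1 = ≈0⇒∣ (subst (_≈ +0) (sym (pos-∸ (m^n>0 2 (double m))))
    (x≈y⇒x-y≈0 (fermat-little (s≤s z≤n) (s≤s (s≤s (s≤s z≤n))))))

  2^[p-1]≡q*p+1 : 2 ^ double m ≡ q * p + 1
  2^[p-1]≡q*p+1 = trans (sym (m∸n+n≡m (m^n>0 2 (double m)))) (cong (_+ 1) (sym (m/n*n≡m p∣2^[p-1]-1)))

  Σbinomial/p≡2q : ℕΣ< (double m) binomial/p ≡ 2 * q
  Σbinomial/p≡2q = *-cancelʳ-≡ _ _ p (+-cancelˡ-≡ 1 _ _ (+-cancelʳ-≡ 1 _ _ (begin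
    1 + ℕΣ< (double m) binomial/p * p + 1                 ≡⟨ cong (λ x → 1 + x + 1) (Σ<-*ʳ (double m) p binomial/p) ⟨
    1 + ℕΣ< (double m) (λ k → binomial/p k * p) + 1       ≡⟨ 2^p≡ ⟨
    2 * 2 ^ double m                                      ≡⟨ cong (2 *_) 2^[p-1]≡q*p+1 ⟩
    2 * (q * p + 1)                                       ≡⟨ rearrange q p ⟩
    1 + 2 * q * p + 1                                     ∎)))
    where
      open ≡-Reasoning
      rearrange : ∀ q p → 2 * (q * p + 1) ≡ 1 + 2 * q * p + 1
      rearrange = solve-∀

  Σbinomial/p≈2H : + ℕΣ< (double m) binomial/p ≈ H ℤ.+ H
  Σbinomial/p≈2H = begin
    + ℕΣ< (double m) binomial/p                                ≡⟨ pos-Σ< (double m) binomial/p ⟩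
    Σ< (double m) (λ k → + binomial/p k)                       ≈⟨ Σ<-cong (double m) (λ k k<2m → binomial/p≈ k<2m) ⟩
    Σ< (double m) (λ k → alternating k ℤ.* inverse (suc k))    ≡⟨ Σ<-double m _ ⟩
    Σ< m (λ s → alternating (double s) ℤ.* inverse (suc (double s)))
      ℤ.+ Σ< m (λ s → - alternating (double s) ℤ.* inverse (suc (suc (double s))))
      ≡⟨ cong₂ ℤ._+_ (ℤΣ.Σ<-cong m (λ s _ → trans (cong (ℤ._* inverse (suc (double s))) (alternating-double s)) (ℤP.*-identityˡ _)))
                     (ℤΣ.Σ<-cong m (λ s _ → trans (cong (λ x → - x ℤ.* inverse (suc (suc (double s)))) (alternating-double s)) (ℤP.-1*i≡-i _))) ⟩
    H ℤ.+ Σ< m (λ s → - inverse (suc (suc (double s))))        ≈⟨ +-cong (≈-refl {H}) Σ-neg-even-inverse≈H ⟩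
    H ℤ.+ H                                                    ∎
    where open ≈-Reasoning

  q≈H : + q ≈ H
  q≈H = *-cancelˡ-≈ {+ 2} (0<k<p⇒p∤k (s≤s z≤n) (s≤s (s≤s (s≤s z≤n)))) (begin
    + 2 ℤ.* + q                   ≡⟨ ℤP.pos-* 2 q ⟨
    + (2 * q)                     ≡⟨ cong +_ Σbinomial/p≡2q ⟨
    + ℕΣ< (double m) binomial/p   ≈⟨ Σbinomial/p≈2H ⟩
    H ℤ.+ H                       ≡⟨ twice H ⟩
    + 2 ℤ.* H                     ∎)
    where
      open ≈-Reasoning
      twice : ∀ x → x ℤ.+ x ≡ + 2 ℤ.* x
      twice = ℤSolver.solve-∀


module Eulerian where

  open import Data.Nat
  open import Data.Nat.Properties
  open import Data.Nat.Tactic.RingSolver using (solve)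
  open import Data.List using ([]; _∷_)
  open import Relation.Binary.PropositionalEquality
  open import Relation.Nullary using (yes; no)
  import Data.Nat.Tactic.RingSolver
  open Binomial
  open ℕΣ

  eulerian : ℕ → ℕ → ℕ
  eulerian zero    zero    = 1
  eulerian zero    (suc k) = 0
  eulerian (suc n) zero    = eulerian n zero
  eulerian (suc n) (suc k) = suc (suc k) * eulerian n (suc k) + (n ∸ k) * eulerian n k

  eulerian-≡0 : ∀ {n k} → n < k → eulerian n k ≡ 0
  eulerian-≡0 {zero}  {suc k} _         = refl
  eulerian-≡0 {suc n} {suc k} (s≤s n<k) rewrite eulerian-≡0 (m<n⇒m<1+n n<k) | eulerian-≡0 n<k =
    cong₂ _+_ (*-zeroʳ (suc (suc k))) (*-zeroʳ (n ∸ k))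

  eulerian-0 : ∀ n → eulerian n 0 ≡ 1
  eulerian-0 zero    = refl
  eulerian-0 (suc n) = eulerian-0 n

  worpitzky-coefficient : ∀ n k a → k ≤ n →
    binomial (suc n + a) (suc n) * suc k + binomial (n + a) (suc n) * (n ∸ k) ≡ suc (k + a) * binomial (n + a) n
  worpitzky-coefficient n k a k≤n =
    step (binomial (n + a) n) (binomial (n + a) (suc n)) (n ∸ k) (binomial-ratio (n + a) n) (sym (m+[n∸m]≡n k≤n))
    where
      step : ∀ x y r → suc n * y + n * x ≡ (n + a) * x → n ≡ k + r → (x + y) * suc k + y * r ≡ suc (k + a) * x
      step x y r ratio refl = +-cancelʳ-≡ ((k + r) * x) _ _ (begin
        (x + y) * suc k + y * r + (k + r) * x               ≡⟨ solve (x ∷ y ∷ k ∷ r ∷ []) ⟩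
        x * suc k + (suc (k + r) * y + (k + r) * x)         ≡⟨ cong (x * suc k +_) ratio ⟩
        x * suc k + (k + r + a) * x                         ≡⟨ solve (x ∷ k ∷ r ∷ a ∷ []) ⟩
        suc (k + a) * x + (k + r) * x                       ∎)
        where open ≡-Reasoning

  worpitzky-term : ∀ n j k → k ≤ j →
    (binomial (suc n + (j ∸ k)) (suc n) * suc k + binomial (n + (j ∸ k)) (suc n) * (n ∸ k)) * eulerian n k
      ≡ suc j * (binomial (n + (j ∸ k)) n * eulerian n k)
  worpitzky-term n j k k≤j with k ≤? n
  ... | yes k≤n = begin
    (binomial (suc n + (j ∸ k)) (suc n) * suc k + binomial (n + (j ∸ k)) (suc n) * (n ∸ k)) * eulerian n k
      ≡⟨ cong (_* eulerian n k) (worpitzky-coefficient n k (j ∸ k) k≤n) ⟩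
    suc (k + (j ∸ k)) * binomial (n + (j ∸ k)) n * eulerian n k
      ≡⟨ cong (λ i → suc i * binomial (n + (j ∸ k)) n * eulerian n k) (m+[n∸m]≡n k≤j) ⟩
    suc j * binomial (n + (j ∸ k)) n * eulerian n k
      ≡⟨ *-assoc (suc j) (binomial (n + (j ∸ k)) n) (eulerian n k) ⟩
    suc j * (binomial (n + (j ∸ k)) n * eulerian n k) ∎
    where open ≡-Reasoning
  ... | no k≰n rewrite eulerian-≡0 (≰⇒> k≰n) =
    trans (*-zeroʳ (binomial (suc n + (j ∸ k)) (suc n) * suc k + binomial (n + (j ∸ k)) (suc n) * (n ∸ k)))
          (sym (trans (cong (suc j *_) (*-zeroʳ (binomial (n + (j ∸ k)) n))) (*-zeroʳ (suc j))))

  worpitzky : ∀ n j → suc j ^ n ≡ Σ< (suc j) (λ k → binomial (n + (j ∸ k)) n * eulerian n k)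
  worpitzky zero    j = sym (trans (Σ<-shift j _) (cong (1 +_) (Σ<-zero j (λ _ _ → refl))))
  worpitzky (suc n) j = sym (begin
    Σ< (suc j) (λ k → T k * eulerian (suc n) k)
      ≡⟨ Σ<-shift j _ ⟩
    T 0 * eulerian n 0 + Σ< j (λ k → T (suc k) * (suc (suc k) * eulerian n (suc k) + (n ∸ k) * eulerian n k))
      ≡⟨ cong (T 0 * eulerian n 0 +_) (trans (Σ<-cong j (λ k _ → distribute (T (suc k)) (suc (suc k)) _ (n ∸ k) _)) (Σ<-+ j _ _)) ⟩
    T 0 * eulerian n 0 + (Σ< j (λ k → U (suc k)) + Σ< j (λ k → T (suc k) * (n ∸ k) * eulerian n k))
      ≡⟨ +-assoc (T 0 * eulerian n 0) _ _ ⟨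
    (T 0 * eulerian n 0 + Σ< j (λ k → U (suc k))) + Σ< j (λ k → T (suc k) * (n ∸ k) * eulerian n k)
      ≡⟨ cong₂ _+_ (trans (cong (λ x → x * eulerian n 0 + Σ< j (λ k → U (suc k))) (sym (*-identityʳ (T 0)))) (sym (Σ<-shift j U)))
                   (trans (Σ<-cong j (λ k k<j → cong (λ i → binomial i (suc n) * (n ∸ k) * eulerian n k) (T-shift k<j))) (sym V-last)) ⟩
    Σ< (suc j) U + Σ< (suc j) V
      ≡⟨ Σ<-+ (suc j) U V ⟨
    Σ< (suc j) (λ k → U k + V k)
      ≡⟨ Σ<-cong (suc j) (λ k k<1+j → trans (sym (*-distribʳ-+ (eulerian n k) (T k * suc k) _)) (worpitzky-term n j k (≤-pred k<1+j))) ⟩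
    Σ< (suc j) (λ k → suc j * (binomial (n + (j ∸ k)) n * eulerian n k))
      ≡⟨ Σ<-*ˡ (suc j) (suc j) _ ⟩
    suc j * Σ< (suc j) (λ k → binomial (n + (j ∸ k)) n * eulerian n k)
      ≡⟨ cong (suc j *_) (worpitzky n j) ⟨
    suc j ^ suc n ∎)
    where
      open ≡-Reasoning
      T : ℕ → ℕ
      T k = binomial (suc n + (j ∸ k)) (suc n)
      U : ℕ → ℕ
      U k = T k * suc k * eulerian n k
      V : ℕ → ℕ
      V k = binomial (n + (j ∸ k)) (suc n) * (n ∸ k) * eulerian n k
      distribute : ∀ t a b x y → t * (a * b + x * y) ≡ t * a * b + t * x * y
      distribute = Data.Nat.Tactic.RingSolver.solve-∀
      T-shift : ∀ {k} → k < j → suc n + (j ∸ suc k) ≡ n + (j ∸ k)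
      T-shift {k} k<j = trans (sym (+-suc n (j ∸ suc k))) (cong (n +_) (sym (+-∸-assoc 1 k<j)))
      V-last : Σ< (suc j) V ≡ Σ< j V
      V-last = trans (cong (Σ< j V +_) (begin
        binomial (n + (j ∸ j)) (suc n) * (n ∸ j) * eulerian n j ≡⟨ cong (λ i → binomial (n + i) (suc n) * (n ∸ j) * eulerian n j) (n∸n≡0 j) ⟩
        binomial (n + 0) (suc n) * (n ∸ j) * eulerian n j
          ≡⟨ cong (λ i → i * (n ∸ j) * eulerian n j) (binomial-≡0 {n + 0} {suc n} (s≤s (≤-reflexive (+-identityʳ n)))) ⟩
        0                                                       ∎)) (+-identityʳ _)


module PartialSums where

  open import Data.Nat as ℕ using (_∸_; _≤_)
  open import Data.Nat.Properties using (+-∸-assoc; n∸n≡0; ≤-refl; <⇒≤)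
  open import Data.Integer using (+_; _+_; _*_; +0)
  open import Data.Integer.Properties using (*-identityˡ; +-identityʳ; *-zeroʳ)
  open import Data.Integer.Tactic.RingSolver using (solve-∀)
  open import Relation.Binary.PropositionalEquality
  open ℤΣ

  Σ<-const : ∀ k a → Σ< k (λ _ → a) ≡ a * + k
  Σ<-const zero    a = sym (*-zeroʳ a)
  Σ<-const (suc k) a = trans (cong (_+ a) (Σ<-const k a)) (step a (+ k))
    where
      step : ∀ a x → a * x + a ≡ a * (+ 1 + x)
      step = solve-∀

  private
    one-more : ∀ {a b} → a ≤ b → ∀ y → + (suc b ∸ a) * y ≡ + (b ∸ a) * y + y
    one-more {a} {b} a≤b y = trans (cong (λ n → + n * y) (+-∸-assoc 1 a≤b)) (step (+ (b ∸ a)) y)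
      where
        step : ∀ x y → (+ 1 + x) * y ≡ x * y + y
        step = solve-∀

  -- F (2s) occurs in the partial sums for t = s, …, k−1, and F (2s+1) in those for t = s+1, …, k−1.
  Σ<-partial-sums-at-evens : ∀ k F →
    Σ< k (λ t → Σ< (suc (double t)) F)
      ≡ Σ< k (λ s → + (k ∸ s) * F (double s)) + Σ< k (λ s → + (k ∸ suc s) * F (suc (double s)))
  Σ<-partial-sums-at-evens zero    F = refl
  Σ<-partial-sums-at-evens (suc k) F = begin
    Σ< k (λ t → Σ< (suc (double t)) F) + Σ< (suc (double k)) F
      ≡⟨ cong₂ (λ x y → x + (y + F (double k))) (Σ<-partial-sums-at-evens k F) (Σ<-double k F) ⟩
    (A + B) + ((E + O) + F (double k))
      ≡⟨ rearrange A B E O (F (double k)) ⟩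
    (A + E + F (double k)) + (B + O)
      ≡⟨ cong₂ _+_ (cong₂ _+_ evens (sym last-even)) (trans (sym (+-identityʳ (B + O))) (cong₂ _+_ odds (sym last-odd))) ⟩
    (Σ< k (λ s → + (suc k ∸ s) * F (double s)) + + (suc k ∸ k) * F (double k))
      + (Σ< k (λ s → + (k ∸ s) * F (suc (double s))) + + (k ∸ k) * F (suc (double k)))
      ∎
    where
      open ≡-Reasoning
      A = Σ< k (λ s → + (k ∸ s) * F (double s))
      B = Σ< k (λ s → + (k ∸ suc s) * F (suc (double s)))
      E = Σ< k (λ s → F (double s))
      O = Σ< k (λ s → F (suc (double s)))
      rearrange : ∀ a b e o x → (a + b) + ((e + o) + x) ≡ (a + e + x) + (b + o)
      rearrange = solve-∀
      evens : A + E ≡ Σ< k (λ s → + (suc k ∸ s) * F (double s))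
      evens = trans (sym (Σ<-+ k _ _)) (Σ<-cong k (λ s s<k → sym (one-more (<⇒≤ s<k) (F (double s)))))
      odds : B + O ≡ Σ< k (λ s → + (k ∸ s) * F (suc (double s)))
      odds = trans (sym (Σ<-+ k _ _)) (Σ<-cong k (λ s s<k → sym (one-more s<k (F (suc (double s))))))
      last-even : + (suc k ∸ k) * F (double k) ≡ F (double k)
      last-even = trans (cong (λ n → + n * F (double k)) (trans (+-∸-assoc 1 (≤-refl {k})) (cong suc (n∸n≡0 k)))) (*-identityˡ _)
      last-odd : + (k ∸ k) * F (suc (double k)) ≡ +0
      last-odd = cong (λ n → + n * F (suc (double k))) (n∸n≡0 k)


module EulerianModP (m′ : ℕ) (p-prime : Data.Nat.Primality.Prime (suc (double (suc m′)))) where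

  open import Data.Nat as ℕ using (_+_; _*_; _∸_; _^_; _<_; _≤_; z≤n; s≤s)
  open import Data.Nat.Properties
    using (+-suc; +-comm; +-identityʳ; *-identityˡ; *-distribʳ-+; +-cancelʳ-≡; ^-zeroˡ; n∸n≡0; m+n∸n≡m; m∸n≤m;
           ≤-trans; n≤1+n; <⇒≤; ≤-pred; <-trans; n<1+n; +-∸-assoc; m∸[m∸n]≡n)
  open import Data.Nat.Divisibility using (_∣_; m∣m*n; ∣m⇒∣m*n; ∣n⇒∣m*n; ∣m+n∣m⇒∣n)
  open import Data.Integer as ℤ using (ℤ; +_; -_; +0)
  import Data.Integer.Properties as ℤP
  open import Data.Integer.Tactic.RingSolver using (solve)
  open import Data.List using ([]; _∷_)
  open import Relation.Binary.PropositionalEquality hiding (setoid)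
  open Binomial
  open Eulerian
  open SumDivisibility
  open IntegerFacts
  open OddPrime m′ p-prime
  open ℤΣ using (Σ<)

  e : ℕ
  e = suc (double m′)

  p∣binomial[e+t,e] : ∀ {t} → suc (suc t) < p → p ∣ binomial (e + suc (suc t)) e
  p∣binomial[e+t,e] {t} t+2<p = subst (p ∣_) (sym (binomial-sym e (suc (suc t)))) p∣C₂
    where
      n′ = e + suc (suc t)
      C₀ = binomial n′ t
      C₁ = binomial n′ (suc t)
      C₂ = binomial n′ (suc (suc t))
      n′≡p+t : n′ ≡ p + t
      n′≡p+t = trans (+-suc e (suc t)) (cong suc (+-suc e t))
      [1+t]C₁≡pC₀ : suc t * C₁ ≡ p * C₀
      [1+t]C₁≡pC₀ = +-cancelʳ-≡ (t * C₀) _ _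
        (trans (binomial-ratio n′ t) (trans (cong (_* C₀) n′≡p+t) (*-distribʳ-+ C₀ p t)))
      p∣C₁ : p ∣ C₁
      p∣C₁ = ∣-cancelˡ (0<k<p⇒p∤k (s≤s z≤n) (<-trans (n<1+n (suc t)) t+2<p))
        (subst (p ∣_) (sym [1+t]C₁≡pC₀) (m∣m*n C₀))
      p∣C₂ : p ∣ C₂
      p∣C₂ = ∣-cancelˡ (0<k<p⇒p∤k (s≤s z≤n) t+2<p)
        (∣m+n∣m⇒∣n (subst (p ∣_) (trans (sym (binomial-ratio n′ (suc t))) (+-comm (suc (suc t) * C₂) _)) (∣n⇒∣m*n n′ p∣C₁))
                   (∣n⇒∣m*n (suc t) p∣C₁))

  inverse-sum : ℕ → ℤ
  inverse-sum j = Σ< (suc j) (λ i → inverse (suc i))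

  p-1≈-1 : + suc e ≈ - + 1
  p-1≈-1 = +-cong m≈0 (≈-refl { - + 1})

  -- Worpitzky's identity at j+2 reduces modulo p to a two-term recurrence.
  eulerian-step : ∀ {j} → suc j ≤ e → + eulerian e (suc j) ≈ + eulerian e j ℤ.+ inverse (suc (suc j))
  eulerian-step {j} j+1≤e = begin
    + eulerian e (suc j)                                      ≡⟨ isolate {a = + M} {+ suc e} {+ eulerian e j} main ⟩
    inverse (suc (suc j)) ℤ.- + M ℤ.- + suc e ℤ.* + eulerian e j
      ≈⟨ +-cong (+-cong (≈-refl {inverse (suc (suc j))}) (-‿cong (∣⇒≈0 {+ M} p∣M))) (-‿cong (*-cong p-1≈-1 (≈-refl {+ eulerian e j}))) ⟩
    inverse (suc (suc j)) ℤ.- +0 ℤ.- - + 1 ℤ.* + eulerian e j ≡⟨ simplify (inverse (suc (suc j))) (+ eulerian e j) ⟩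
    + eulerian e j ℤ.+ inverse (suc (suc j))                  ∎
    where
      open ≈-Reasoning
      f : ℕ → ℕ
      f k = binomial (e + (suc j ∸ k)) e * eulerian e k
      M = ℕΣ.Σ< j f
      p∣M : p ∣ M
      p∣M = ∣-Σ< j f (λ k k<j → ∣m⇒∣m*n (eulerian e k)
        (subst (λ i → p ∣ binomial (e + i) e) (sym (trans (+-∸-assoc 1 (<-trans k<j (n<1+n j))) (cong suc (+-∸-assoc 1 k<j))))
          (p∣binomial[e+t,e] (s≤s (s≤s (≤-trans (s≤s (m∸n≤m j (suc k))) j+1≤e))))))
      f-j : f j ≡ suc e * eulerian e j
      f-j = cong (_* eulerian e j) (trans (cong (λ i → binomial (e + i) e) (m+n∸n≡m 1 j))
              (trans (cong (λ i → binomial i e) (+-comm e 1)) (binomial-[1+n]n e)))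
      f-1+j : f (suc j) ≡ eulerian e (suc j)
      f-1+j = trans (cong (λ i → binomial (e + i) e * eulerian e (suc j)) (n∸n≡0 (suc j)))
                (trans (cong (λ i → binomial i e * eulerian e (suc j)) (+-identityʳ e))
                  (trans (cong (_* eulerian e (suc j)) (binomial-diag e)) (*-identityˡ _)))
      main : inverse (suc (suc j)) ≡ + M ℤ.+ + suc e ℤ.* + eulerian e j ℤ.+ + eulerian e (suc j)
      main = trans (cong +_ (trans (worpitzky e (suc j)) (cong₂ (λ x y → M + x + y) f-j f-1+j)))
                   (cong (λ x → + M ℤ.+ x ℤ.+ + eulerian e (suc j)) (ℤP.pos-* (suc e) (eulerian e j)))
      isolate : ∀ {x a s b y} → x ≡ a ℤ.+ s ℤ.* b ℤ.+ y → y ≡ x ℤ.- a ℤ.- s ℤ.* b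
      isolate {a = a} {s} {b} {y} refl = solve (a ∷ s ∷ b ∷ y ∷ [])
      simplify : ∀ x a → x ℤ.- +0 ℤ.- - + 1 ℤ.* a ≡ a ℤ.+ x
      simplify x a = solve (x ∷ a ∷ [])

  eulerian≈inverse-sum : ∀ {j} → j ≤ e → + eulerian e j ≈ inverse-sum j
  eulerian≈inverse-sum {zero}  _     = ≈-reflexive (cong +_ (trans (eulerian-0 e) (sym (^-zeroˡ e))))
  eulerian≈inverse-sum {suc j} j+1≤e =
    ≈-trans (eulerian-step j+1≤e) (+-cong (eulerian≈inverse-sum (≤-trans (n≤1+n j) j+1≤e)) ≈-refl)

  even-eulerian-sum : ℕ
  even-eulerian-sum = ℕΣ.Σ< m (λ t → eulerian e (double t))

  private
    odd-inverse : ℕ → ℤ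
    odd-inverse s = inverse (suc (double s))

    pos-double : ∀ n → + double n ≡ + 2 ℤ.* + n
    pos-double n = trans (cong +_ (DoubleProperties.double≡2* n)) (ℤP.pos-* 2 n)

    Σ-odd-coefficients : Σ< m (λ s → + (m ∸ suc s) ℤ.* inverse (suc (suc (double s)))) ≈ Σ< m (λ s → + s ℤ.* - odd-inverse s)
    Σ-odd-coefficients = begin
      Σ< m (λ s → + (m ∸ suc s) ℤ.* inverse (suc (suc (double s))))
        ≡⟨ ℤΣ.Σ<-reverse m _ ⟩
      Σ< m (λ s → + (m ∸ suc (m ∸ suc s)) ℤ.* inverse (suc (suc (double (m ∸ suc s)))))
        ≡⟨ ℤΣ.Σ<-cong m (λ s s<m → cong₂ (λ a i → + a ℤ.* inverse i) (reflect s<m) (double-reflect s<m)) ⟩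
      Σ< m (λ s → + s ℤ.* inverse (p ∸ suc (double s)))
        ≈⟨ Σ<-cong m (λ s s<m → *-cong (≈-refl {+ s}) (inverse-reflect (s≤s (double-mono-≤ (<⇒≤ s<m))))) ⟩
      Σ< m (λ s → + s ℤ.* - odd-inverse s) ∎
      where
        open ≈-Reasoning
        open DoubleProperties using (double-reflect; double-mono-≤)
        reflect : ∀ {s} → s < m → m ∸ suc (m ∸ suc s) ≡ s
        reflect {s} s<m = trans (cong (m ∸_) (sym (+-∸-assoc 1 s<m))) (m∸[m∸n]≡n (<⇒≤ s<m))

    coefficient : ∀ {s} → s < m → + 2 ℤ.* (+ (m ∸ s) ℤ.* odd-inverse s ℤ.+ + s ℤ.* - odd-inverse s) ≈ - + 2 ℤ.+ odd-inverse s
    coefficient {s} s<m = step (odd-inverse s) (*-inverse (s≤s z≤n) (s≤s (double-mono-< s<m)))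
      where
        open ≈-Reasoning
        open DoubleProperties using (double-mono-<)
        step : ∀ x → + suc (double s) ℤ.* x ≈ + 1 → + 2 ℤ.* (+ (m ∸ s) ℤ.* x ℤ.+ + s ℤ.* - x) ≈ - + 2 ℤ.+ x
        step x [2s+1]x≈1 = begin
          + 2 ℤ.* (+ (m ∸ s) ℤ.* x ℤ.+ + s ℤ.* - x)
            ≡⟨ cong (λ y → + 2 ℤ.* (y ℤ.* x ℤ.+ + s ℤ.* - x)) (pos-∸ (<⇒≤ s<m)) ⟩
          + 2 ℤ.* ((+ m ℤ.- + s) ℤ.* x ℤ.+ + s ℤ.* - x)
            ≡⟨ regroup (+ m) (+ s) x ⟩
          (+ 1 ℤ.+ + 2 ℤ.* + m) ℤ.* x ℤ.- + 2 ℤ.* ((+ 1 ℤ.+ + 2 ℤ.* + s) ℤ.* x) ℤ.+ x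
            ≡⟨ cong₂ (λ a b → (+ 1 ℤ.+ a) ℤ.* x ℤ.- + 2 ℤ.* ((+ 1 ℤ.+ b) ℤ.* x) ℤ.+ x) (pos-double m) (pos-double s) ⟨
          + p ℤ.* x ℤ.- + 2 ℤ.* (+ suc (double s) ℤ.* x) ℤ.+ x
            ≈⟨ +-cong (+-cong (*-cong m≈0 (≈-refl {x})) (-‿cong (*-cong (≈-refl {+ 2}) [2s+1]x≈1))) (≈-refl {x}) ⟩
          +0 ℤ.* x ℤ.- + 2 ℤ.* + 1 ℤ.+ x
            ≡⟨ solve (x ∷ []) ⟩
          - + 2 ℤ.+ x ∎
          where
            regroup : ∀ a b x → + 2 ℤ.* ((a ℤ.- b) ℤ.* x ℤ.+ b ℤ.* - x)
                                ≡ (+ 1 ℤ.+ + 2 ℤ.* a) ℤ.* x ℤ.- + 2 ℤ.* ((+ 1 ℤ.+ + 2 ℤ.* b) ℤ.* x) ℤ.+ x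
            regroup a b x = solve (a ∷ b ∷ x ∷ [])

  2*even-eulerian-sum≈1+H : + (2 * even-eulerian-sum) ≈ + 1 ℤ.+ H
  2*even-eulerian-sum≈1+H = begin
    + (2 * even-eulerian-sum)
      ≡⟨ trans (ℤP.pos-* 2 even-eulerian-sum) (cong (+ 2 ℤ.*_) (pos-Σ< m (λ t → eulerian e (double t)))) ⟩
    + 2 ℤ.* Σ< m (λ t → + eulerian e (double t))
      ≈⟨ *-cong (≈-refl {+ 2}) (Σ<-cong m (λ t t<m → eulerian≈inverse-sum (≤-trans (double-mono-≤ (≤-pred t<m)) (n≤1+n _)))) ⟩
    + 2 ℤ.* Σ< m (λ t → inverse-sum (double t))
      ≡⟨ cong (+ 2 ℤ.*_) (Σ<-partial-sums-at-evens m (λ i → inverse (suc i))) ⟩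
    + 2 ℤ.* (Σ< m (λ s → + (m ∸ s) ℤ.* odd-inverse s) ℤ.+ Σ< m (λ s → + (m ∸ suc s) ℤ.* inverse (suc (suc (double s)))))
      ≈⟨ *-cong (≈-refl {+ 2}) (+-cong (≈-refl {Σ< m (λ s → + (m ∸ s) ℤ.* odd-inverse s)}) Σ-odd-coefficients) ⟩
    + 2 ℤ.* (Σ< m (λ s → + (m ∸ s) ℤ.* odd-inverse s) ℤ.+ Σ< m (λ s → + s ℤ.* - odd-inverse s))
      ≡⟨ trans (cong (+ 2 ℤ.*_) (sym (ℤΣ.Σ<-+ m _ _))) (sym (ℤΣ.Σ<-*ˡ m (+ 2) _)) ⟩
    Σ< m (λ s → + 2 ℤ.* (+ (m ∸ s) ℤ.* odd-inverse s ℤ.+ + s ℤ.* - odd-inverse s))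
      ≈⟨ Σ<-cong m (λ s s<m → coefficient s<m) ⟩
    Σ< m (λ s → - + 2 ℤ.+ odd-inverse s)
      ≡⟨ trans (ℤΣ.Σ<-+ m _ _) (cong (ℤ._+ H) (Σ<-const m (- + 2))) ⟩
    - + 2 ℤ.* + m ℤ.+ H
      ≡⟨ cong (ℤ._+ H) (trans (regroup (+ m)) (cong (λ x → + 1 ℤ.- (+ 1 ℤ.+ x)) (sym (pos-double m)))) ⟩
    + 1 ℤ.- + p ℤ.+ H
      ≈⟨ +-cong (+-cong (≈-refl {+ 1}) (-‿cong m≈0)) (≈-refl {H}) ⟩
    + 1 ℤ.+ H ∎
    where
      open ≈-Reasoning
      open DoubleProperties using (double-mono-≤)
      open PartialSums
      regroup : ∀ x → - + 2 ℤ.* x ≡ + 1 ℤ.- (+ 1 ℤ.+ + 2 ℤ.* x)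
      regroup x = solve (x ∷ [])


module OddHarmonicFraction where

  open import Data.Nat as ℕ using (_*_)
  open import Data.Integer as ℤ using (ℤ; +_)
  import Data.Integer.Properties as ℤP
  import Data.Integer.GCD as ℤGCD
  open import Data.Integer.Tactic.RingSolver using (solve)
  open import Data.List using ([]; _∷_)
  open import Data.Rational as ℚ using (ℚ; mkℚ; ↥_; ↧_)
  import Data.Rational.Properties as ℚP
  import Data.Rational.Unnormalised as ℚᵘ
  open import Relation.Binary.PropositionalEquality
  open Defs using (oddHarmonic)

  ↥-+ : ∀ x y → ↥ (x ℚ.+ y) ℤ.* (↧ x ℤ.* ↧ y) ≡ (↥ x ℤ.* ↧ y ℤ.+ ↥ y ℤ.* ↧ x) ℤ.* ↧ (x ℚ.+ y)
  ↥-+ x@(mkℚ _ _ _) y@(mkℚ _ _ _) with ℚP.toℚᵘ-homo-+ x y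
  ... | ℚᵘ.*≡* eq = subst₂ (λ a b → a ℤ.* (↧ x ℤ.* ↧ y) ≡ (↥ x ℤ.* ↧ y ℤ.+ ↥ y ℤ.* ↧ x) ℤ.* b)
                           (ℚP.↥ᵘ-toℚᵘ (x ℚ.+ y)) (ℚP.↧ᵘ-toℚᵘ (x ℚ.+ y)) eq

  ↥-1/n : ∀ n .{{_ : ℕ.NonZero n}} → ↥ (+ 1 ℚ./ n) ≡ + 1
  ↥-1/n n = trans (sym (ℤP.*-identityʳ _)) (trans (cong (↥ (+ 1 ℚ./ n) ℤ.*_) (sym (ℤGCD.gcd-zeroˡ (+ n)))) (ℚP.↥-/ (+ 1) n))

  ↧-1/n : ∀ n .{{_ : ℕ.NonZero n}} → ↧ (+ 1 ℚ./ n) ≡ + n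
  ↧-1/n n = trans (sym (ℤP.*-identityʳ _)) (trans (cong (↧ (+ 1 ℚ./ n) ℤ.*_) (sym (ℤGCD.gcd-zeroˡ (+ n)))) (ℚP.↧-/ (+ 1) n))

  odd-product : ℕ → ℕ
  odd-product zero    = 1
  odd-product (suc k) = odd-product k * suc (2 * k)

  -- The numerator of 1 + 1/3 + ⋯ + 1/(2k−1) over the common denominator odd-product k.
  odd-harmonic-numerator : ℕ → ℕ
  odd-harmonic-numerator zero    = 0
  odd-harmonic-numerator (suc k) = odd-harmonic-numerator k * suc (2 * k) ℕ.+ odd-product k

  oddHarmonic-cross : ∀ k → ↥ (oddHarmonic k) ℤ.* + odd-product k ≡ + odd-harmonic-numerator k ℤ.* ↧ (oddHarmonic k)
  oddHarmonic-cross zero    = refl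
  oddHarmonic-cross (suc k) = ℤP.*-cancelˡ-≡ (↧ x) _ _ (begin
    ↧ x ℤ.* (↥ (oddHarmonic (suc k)) ℤ.* + (odd-product k * o))
      ≡⟨ cong (λ d → ↧ x ℤ.* (↥ (oddHarmonic (suc k)) ℤ.* d)) (ℤP.pos-* (odd-product k) o) ⟩
    ↧ x ℤ.* (↥ (oddHarmonic (suc k)) ℤ.* (+ odd-product k ℤ.* + o))
      ≡⟨ step (↥ (oddHarmonic (suc k))) (↥ x) (↧ x) (↧ (oddHarmonic (suc k))) (+ o) (+ odd-product k) (+ odd-harmonic-numerator k)
              sum (oddHarmonic-cross k) ⟩
    ↧ x ℤ.* ((+ odd-harmonic-numerator k ℤ.* + o ℤ.+ + odd-product k) ℤ.* ↧ (oddHarmonic (suc k)))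
      ≡⟨ cong (λ s → ↧ x ℤ.* ((s ℤ.+ + odd-product k) ℤ.* ↧ (oddHarmonic (suc k)))) (ℤP.pos-* (odd-harmonic-numerator k) o) ⟨
    ↧ x ℤ.* (+ odd-harmonic-numerator (suc k) ℤ.* ↧ (oddHarmonic (suc k))) ∎)
    where
      open ≡-Reasoning
      x = oddHarmonic k
      o = suc (2 * k)
      sum : ↥ (oddHarmonic (suc k)) ℤ.* (↧ x ℤ.* + o) ≡ (↥ x ℤ.* + o ℤ.+ + 1 ℤ.* ↧ x) ℤ.* ↧ (oddHarmonic (suc k))
      sum = subst₂ (λ u v → ↥ (oddHarmonic (suc k)) ℤ.* (↧ x ℤ.* v) ≡ (↥ x ℤ.* v ℤ.+ u ℤ.* ↧ x) ℤ.* ↧ (oddHarmonic (suc k)))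
                   (↥-1/n o) (↧-1/n o) (↥-+ x (+ 1 ℚ./ o))
      step : ∀ a b c e n d s → a ℤ.* (c ℤ.* n) ≡ (b ℤ.* n ℤ.+ + 1 ℤ.* c) ℤ.* e → b ℤ.* d ≡ s ℤ.* c →
             c ℤ.* (a ℤ.* (d ℤ.* n)) ≡ c ℤ.* ((s ℤ.* n ℤ.+ d) ℤ.* e)
      step a b c e n d s a-eq b-eq = begin
        c ℤ.* (a ℤ.* (d ℤ.* n))                  ≡⟨ solve (a ∷ c ∷ d ∷ n ∷ []) ⟩
        d ℤ.* (a ℤ.* (c ℤ.* n))                  ≡⟨ cong (d ℤ.*_) a-eq ⟩
        d ℤ.* ((b ℤ.* n ℤ.+ + 1 ℤ.* c) ℤ.* e)    ≡⟨ solve (b ∷ c ∷ e ∷ n ∷ d ∷ []) ⟩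
        (b ℤ.* d) ℤ.* n ℤ.* e ℤ.+ d ℤ.* c ℤ.* e  ≡⟨ cong (λ t → t ℤ.* n ℤ.* e ℤ.+ d ℤ.* c ℤ.* e) b-eq ⟩
        (s ℤ.* c) ℤ.* n ℤ.* e ℤ.+ d ℤ.* c ℤ.* e  ≡⟨ solve (c ∷ e ∷ n ∷ d ∷ s ∷ []) ⟩
        c ℤ.* ((s ℤ.* n ℤ.+ d) ℤ.* e)            ∎


module OddHarmonicResidue (m′ : ℕ) (p-prime : Data.Nat.Primality.Prime (suc (double (suc m′)))) where

  open import Data.Nat as ℕ using (_*_; _<_; _≤_; z≤n; s≤s)
  open import Data.Nat.Properties using (≤-trans; ≤-refl; n≤1+n)
  open import Data.Nat.Divisibility using (_∣_; ∣m⇒∣m*n)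
  open import Data.Nat.Coprimality using (Coprime; coprime?)
  open import Data.Nat.Primality using (euclidsLemma)
  open import Data.Integer as ℤ using (ℤ; +_; +0; ∣_∣)
  import Data.Integer.Properties as ℤP
  open import Data.Integer.Tactic.RingSolver using (solve-∀)
  open import Data.Rational as ℚ using (ℚ; mkℚ; ↥_; ↧_)
  open import Data.Product using (_,_)
  open import Data.Sum using ([_,_]′)
  open import Function using (_⇔_; mk⇔; id)
  open import Relation.Nullary using (¬_; contradiction)
  open import Relation.Nullary.Decidable using (recompute)
  open import Relation.Binary.PropositionalEquality hiding (setoid)
  open Defs using (oddHarmonic; ResidueZero)
  open OddHarmonicFraction
  open OddPrime m′ p-prime hiding (_,_)
  open ℤΣ using (Σ<)

  private
    odd≡ : ∀ k → suc (2 * k) ≡ suc (double k)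
    odd≡ k = cong suc (sym (DoubleProperties.double≡2* k))

    odd<p : ∀ {k} → k < m → suc (2 * k) < p
    odd<p {k} k<m rewrite odd≡ k = s≤s (DoubleProperties.double-mono-< k<m)

  p∤odd-product : ∀ {k} → k ≤ m → ¬ p ∣ odd-product k
  p∤odd-product {zero}  _    = 0<k<p⇒p∤k (s≤s z≤n) (s≤s (s≤s z≤n))
  p∤odd-product {suc k} k<m p∣ =
    [ p∤odd-product (≤-trans (n≤1+n k) k<m) , 0<k<p⇒p∤k (s≤s z≤n) (odd<p k<m) ]′
      (euclidsLemma (odd-product k) (suc (2 * k)) p-prime p∣)

  odd-harmonic-numerator≈ : ∀ {k} → k ≤ m → + odd-harmonic-numerator k ≈ + odd-product k ℤ.* Σ< k (λ s → inverse (suc (double s)))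
  odd-harmonic-numerator≈ {zero}  _   = ≈-refl
  odd-harmonic-numerator≈ {suc k} k<m = begin
    + (odd-harmonic-numerator k * o ℕ.+ odd-product k)
      ≡⟨ cong (ℤ._+ + odd-product k) (ℤP.pos-* (odd-harmonic-numerator k) o) ⟩
    + odd-harmonic-numerator k ℤ.* + o ℤ.+ + odd-product k
      ≈⟨ +-cong (*-cong (odd-harmonic-numerator≈ (≤-trans (n≤1+n k) k<m)) (≈-refl {+ o})) (≈-refl {+ odd-product k}) ⟩
    d ℤ.* h ℤ.* + o ℤ.+ d
      ≡⟨ cong (λ t → d ℤ.* h ℤ.* + o ℤ.+ t) (ℤP.*-identityʳ d) ⟨
    d ℤ.* h ℤ.* + o ℤ.+ d ℤ.* + 1
      ≈⟨ +-cong (≈-refl {d ℤ.* h ℤ.* + o}) (*-cong (≈-refl {d}) (≈-sym o*w≈1)) ⟩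
    d ℤ.* h ℤ.* + o ℤ.+ d ℤ.* (+ o ℤ.* w)
      ≡⟨ factor d h (+ o) w ⟩
    (d ℤ.* + o) ℤ.* (h ℤ.+ w)
      ≡⟨ cong (ℤ._* (h ℤ.+ w)) (ℤP.pos-* (odd-product k) o) ⟨
    + odd-product (suc k) ℤ.* Σ< (suc k) (λ s → inverse (suc (double s))) ∎
    where
      open ≈-Reasoning
      o = suc (2 * k)
      d = + odd-product k
      h = Σ< k (λ s → inverse (suc (double s)))
      w = inverse (suc (double k))
      o*w≈1 : + o ℤ.* w ≈ + 1
      o*w≈1 = subst (λ i → + i ℤ.* w ≈ + 1) (sym (odd≡ k)) (*-inverse (s≤s z≤n) (subst (_< p) (odd≡ k) (odd<p k<m)))
      factor : ∀ d h o w → d ℤ.* h ℤ.* o ℤ.+ d ℤ.* (o ℤ.* w) ≡ (d ℤ.* o) ℤ.* (h ℤ.+ w)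
      factor = solve-∀

  ↥-↧-coprime : ∀ x → Coprime ∣ ↥ x ∣ (ℚ.denominatorℕ x)
  ↥-↧-coprime (mkℚ n d c) = recompute (coprime? ∣ n ∣ (suc d)) c

  ResidueZero⇔H≈0 : ResidueZero p (oddHarmonic m) ⇔ H ≈ +0
  ResidueZero⇔H≈0 = mk⇔ to from
    where
      x = oddHarmonic m
      D = odd-product m
      S = odd-harmonic-numerator m
      p∤D : ¬ p ∣ D
      p∤D = p∤odd-product ≤-refl
      cross : ∣ ↥ x ∣ * D ≡ S * ℚ.denominatorℕ x
      cross = trans (sym (ℤP.abs-* (↥ x) (+ D))) (trans (cong ∣_∣ (oddHarmonic-cross m)) (ℤP.abs-* (+ S) (↧ x)))
      S≈DH : + S ≈ + D ℤ.* H
      S≈DH = odd-harmonic-numerator≈ ≤-refl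
      D*0≈0 : + D ℤ.* +0 ≈ +0
      D*0≈0 = ≈-reflexive (ℤP.*-zeroʳ (+ D))
      to : p ∣ ∣ ↥ x ∣ → H ≈ +0
      to p∣↥x = [ p∣S⇒H≈0 , p∣denominator⇒⊥ ]′ (euclidsLemma S (ℚ.denominatorℕ x) p-prime (subst (p ∣_) cross (∣m⇒∣m*n D p∣↥x)))
        where
          p∣S⇒H≈0 : p ∣ S → H ≈ +0
          p∣S⇒H≈0 p∣S = *-cancelˡ-≈ {+ D} p∤D (≈-trans (≈-sym S≈DH) (≈-trans (∣⇒≈0 {+ S} p∣S) (≈-sym D*0≈0)))
          p∣denominator⇒⊥ : p ∣ ℚ.denominatorℕ x → H ≈ +0
          p∣denominator⇒⊥ p∣d with ↥-↧-coprime x (p∣↥x , p∣d)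
          ... | ()
      from : H ≈ +0 → p ∣ ∣ ↥ x ∣
      from H≈0 = [ id , (λ p∣D → contradiction p∣D p∤D) ]′
        (euclidsLemma ∣ ↥ x ∣ D p-prime (subst (p ∣_) (sym cross) (∣m⇒∣m*n (ℚ.denominatorℕ x) (≈0⇒∣ S≈0))))
        where
          S≈0 : + S ≈ +0
          S≈0 = ≈-trans S≈DH (≈-trans (*-cong (≈-refl {+ D}) H≈0) D*0≈0)


module Counting where

  open import Data.Nat using (_+_; _*_)
  open import Data.Nat.Properties using (+-assoc; *-zeroʳ; *-distribˡ-+; +-cancelˡ-≡; 1+n≢0)
  open import Data.Nat.Tactic.RingSolver using (solve-∀)
  open import Data.List using (List; []; _∷_; _++_; map; concatMap; filter; length; upTo; applyUpTo)
  open import Data.List.Membership.Propositional using (_∈_)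
  open import Data.List.Membership.Propositional.Properties using (∈-∃++)
  open import Data.List.Relation.Unary.Any using (here; there)
  open import Data.Product using (_,_)
  open import Level using (0ℓ)
  open import Relation.Binary using (DecidableEquality)
  open import Relation.Nullary using (Dec; yes; no; ¬_; contradiction)
  open import Relation.Unary using (Pred; Decidable)
  open import Relation.Binary.PropositionalEquality
  open ℕΣ using (Σ<; Σ<-shift)

  indicator : ∀ {A : Set} → Dec A → ℕ
  indicator (yes _) = 1
  indicator (no _)  = 0

  indicator-yes : ∀ {A : Set} (a? : Dec A) → A → indicator a? ≡ 1
  indicator-yes (yes _) _ = refl
  indicator-yes (no ¬a) a = contradiction a ¬a

  indicator-no : ∀ {A : Set} (a? : Dec A) → ¬ A → indicator a? ≡ 0
  indicator-no (yes a) ¬a = contradiction a ¬a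
  indicator-no (no _)  _  = refl

  module _ {A : Set} where

    count : {P : Pred A 0ℓ} → Decidable P → List A → ℕ
    count P? xs = length (filter P? xs)

    count-∷ : ∀ {P : Pred A 0ℓ} (P? : Decidable P) x xs → count P? (x ∷ xs) ≡ indicator (P? x) + count P? xs
    count-∷ P? x xs with P? x
    ... | yes _ = refl
    ... | no _  = refl

    count-++ : ∀ {P : Pred A 0ℓ} (P? : Decidable P) xs ys → count P? (xs ++ ys) ≡ count P? xs + count P? ys
    count-++ P? []       ys = refl
    count-++ P? (x ∷ xs) ys = begin
      count P? (x ∷ xs ++ ys)                       ≡⟨ count-∷ P? x (xs ++ ys) ⟩
      indicator (P? x) + count P? (xs ++ ys)        ≡⟨ cong (indicator (P? x) +_) (count-++ P? xs ys) ⟩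
      indicator (P? x) + (count P? xs + count P? ys) ≡⟨ +-assoc (indicator (P? x)) _ _ ⟨
      indicator (P? x) + count P? xs + count P? ys  ≡⟨ cong (_+ count P? ys) (count-∷ P? x xs) ⟨
      count P? (x ∷ xs) + count P? ys               ∎
      where open ≡-Reasoning

    Σ∈ : List A → (A → ℕ) → ℕ
    Σ∈ []       f = 0
    Σ∈ (x ∷ xs) f = f x + Σ∈ xs f

    Σ∈-cong : ∀ xs {f g} → (∀ x → x ∈ xs → f x ≡ g x) → Σ∈ xs f ≡ Σ∈ xs g
    Σ∈-cong []       f≡g = refl
    Σ∈-cong (x ∷ xs) f≡g = cong₂ _+_ (f≡g x (here refl)) (Σ∈-cong xs (λ y y∈xs → f≡g y (there y∈xs)))

    Σ∈-zero : ∀ xs {f} → (∀ x → x ∈ xs → f x ≡ 0) → Σ∈ xs f ≡ 0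
    Σ∈-zero []       f≡0 = refl
    Σ∈-zero (x ∷ xs) f≡0 = cong₂ _+_ (f≡0 x (here refl)) (Σ∈-zero xs (λ y y∈xs → f≡0 y (there y∈xs)))

    Σ∈-+ : ∀ xs f g → Σ∈ xs (λ x → f x + g x) ≡ Σ∈ xs f + Σ∈ xs g
    Σ∈-+ []       f g = refl
    Σ∈-+ (x ∷ xs) f g = trans (cong (f x + g x +_) (Σ∈-+ xs f g)) (interchange (f x) (g x) (Σ∈ xs f) (Σ∈ xs g))
      where
        interchange : ∀ a b c d → a + b + (c + d) ≡ a + c + (b + d)
        interchange = solve-∀

    Σ∈-*ˡ : ∀ xs a f → Σ∈ xs (λ x → a * f x) ≡ a * Σ∈ xs f
    Σ∈-*ˡ []       a f = sym (*-zeroʳ a)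
    Σ∈-*ˡ (x ∷ xs) a f = trans (cong (a * f x +_) (Σ∈-*ˡ xs a f)) (sym (*-distribˡ-+ a (f x) (Σ∈ xs f)))

    count≡Σ∈ : ∀ {P : Pred A 0ℓ} (P? : Decidable P) xs → count P? xs ≡ Σ∈ xs (λ x → indicator (P? x))
    count≡Σ∈ P? []       = refl
    count≡Σ∈ P? (x ∷ xs) = trans (count-∷ P? x xs) (cong (indicator (P? x) +_) (count≡Σ∈ P? xs))

  module _ {A B : Set} where

    count-concatMap : ∀ {P : Pred B 0ℓ} (P? : Decidable P) (f : A → List B) xs →
                      count P? (concatMap f xs) ≡ Σ∈ xs (λ x → count P? (f x))
    count-concatMap P? f []       = refl
    count-concatMap P? f (x ∷ xs) = trans (count-++ P? (f x) (concatMap f xs)) (cong (count P? (f x) +_) (count-concatMap P? f xs))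

    count-map : ∀ {P : Pred B 0ℓ} (P? : Decidable P) (f : A → B) xs → count P? (map f xs) ≡ Σ∈ xs (λ x → indicator (P? (f x)))
    count-map P? f []       = refl
    count-map P? f (x ∷ xs) = trans (count-∷ P? (f x) (map f xs)) (cong (indicator (P? (f x)) +_) (count-map P? f xs))

  Σ∈-applyUpTo : ∀ n (g f : ℕ → ℕ) → Σ∈ (applyUpTo g n) f ≡ Σ< n (λ i → f (g i))
  Σ∈-applyUpTo zero    g f = refl
  Σ∈-applyUpTo (suc n) g f = trans (cong (f (g 0) +_) (Σ∈-applyUpTo n (λ i → g (suc i)) f)) (sym (Σ<-shift n (λ i → f (g i))))

  Σ∈-upTo : ∀ n f → Σ∈ (upTo n) f ≡ Σ< n f
  Σ∈-upTo n = Σ∈-applyUpTo n (λ i → i)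

  module Multiplicity {A : Set} (_≟_ : DecidableEquality A) where

    multiplicity : A → List A → ℕ
    multiplicity v = count (_≟ v)

    indicator-refl : ∀ v → indicator (v ≟ v) ≡ 1
    indicator-refl v = indicator-yes (v ≟ v) refl

    multiplicity≢0⇒∈ : ∀ v ys → multiplicity v ys ≢ 0 → v ∈ ys
    multiplicity≢0⇒∈ v []       m≢0 = contradiction refl m≢0
    multiplicity≢0⇒∈ v (y ∷ ys) m≢0 with y ≟ v
    ... | yes refl = here refl
    ... | no _     = there (multiplicity≢0⇒∈ v ys m≢0)

    ∈⇒multiplicity≢0 : ∀ v ys → v ∈ ys → multiplicity v ys ≢ 0
    ∈⇒multiplicity≢0 v (y ∷ ys) (here refl)   m≡0 =
      1+n≢0 (trans (cong (_+ multiplicity v ys) (sym (indicator-refl v))) (trans (sym (count-∷ (_≟ v) v ys)) m≡0))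
    ∈⇒multiplicity≢0 v (y ∷ ys) (there v∈ys) m≡0 =
      ∈⇒multiplicity≢0 v ys v∈ys (Data.Nat.Properties.m+n≡0⇒n≡0 (indicator (y ≟ v)) (trans (sym (count-∷ (_≟ v) y ys)) m≡0))

    count-middle : ∀ {P : Pred A 0ℓ} (P? : Decidable P) us x vs → count P? (us ++ x ∷ vs) ≡ indicator (P? x) + count P? (us ++ vs)
    count-middle P? us x vs = begin
      count P? (us ++ x ∷ vs)                           ≡⟨ trans (count-++ P? us (x ∷ vs)) (cong (count P? us +_) (count-∷ P? x vs)) ⟩
      count P? us + (indicator (P? x) + count P? vs)    ≡⟨ swap (count P? us) (indicator (P? x)) (count P? vs) ⟩
      indicator (P? x) + (count P? us + count P? vs)    ≡⟨ cong (indicator (P? x) +_) (count-++ P? us vs) ⟨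
      indicator (P? x) + count P? (us ++ vs)            ∎
      where
        open ≡-Reasoning
        swap : ∀ a b c → a + (b + c) ≡ b + (a + c)
        swap = solve-∀

    -- Lists with the same multiplicities are permutations of each other, so every count agrees.
    count-cong-multiplicity : ∀ xs ys → (∀ v → multiplicity v xs ≡ multiplicity v ys) →
                              ∀ {P : Pred A 0ℓ} (P? : Decidable P) → count P? xs ≡ count P? ys
    count-cong-multiplicity []       []       same P? = refl
    count-cong-multiplicity []       (y ∷ ys) same P? =
      contradiction (sym (same y)) (∈⇒multiplicity≢0 y (y ∷ ys) (here refl))
    count-cong-multiplicity (x ∷ xs) ys       same P?
      with ∈-∃++ (multiplicity≢0⇒∈ x ys (λ m≡0 → ∈⇒multiplicity≢0 x (x ∷ xs) (here refl) (trans (same x) m≡0)))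
    ... | us , vs , refl =
      trans (count-∷ P? x xs) (trans (cong (indicator (P? x) +_) (count-cong-multiplicity xs (us ++ vs) same′ P?)) (sym (count-middle P? us x vs)))
      where
        same′ : ∀ v → multiplicity v xs ≡ multiplicity v (us ++ vs)
        same′ v = +-cancelˡ-≡ (indicator (x ≟ v)) _ _
          (trans (sym (count-∷ (_≟ v) x xs)) (trans (same v) (count-middle (_≟ v) us x vs)))


module Permutations where

  open import Data.Nat using (_+_; _*_; _<_; _≤_; z≤n; s≤s; _≟_)
  open import Data.Nat.Properties
    using (<-irrefl; <-≤-trans; ≤-pred; ≤-trans; n<1+n; +-identityʳ; ≤∧≢⇒<; ≤-refl; m≤n⇒m≤1+n;
           *-comm; *-zeroʳ; *-distribˡ-+; suc-injective)
  open import Data.List using (List; []; _∷_; map; filter; length; upTo)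
  open import Data.List.Properties using (≡-dec; ∷-injectiveˡ; ∷-injectiveʳ)
  open import Data.List.Membership.Propositional using (_∈_)
  open import Data.List.Relation.Unary.All using (All; []; _∷_)
  open import Data.List.Relation.Unary.Unique.DecPropositional _≟_ using (Unique; unique?)
  open import Data.Product using (_,_; _×_)
  open import Data.Empty using (⊥-elim)
  open import Level using (0ℓ)
  open import Relation.Nullary using (Dec; yes; no; ¬_)
  open import Relation.Unary using (Pred; Decidable)
  open import Relation.Binary.PropositionalEquality
  open ≡-Reasoning
  open Defs using (letters; words; permutations)
  open Counting
  open ℕΣ using (Σ<; Σ<-zero)

  _≟ₗ_ : (u v : List ℕ) → Dec (u ≡ v)
  _≟ₗ_ = ≡-dec _≟_

  open Multiplicity _≟ₗ_ public
  private module TN = Multiplicity _≟_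

  letters-multiplicity : ℕ → ℕ → ℕ
  letters-multiplicity n y = Σ< n (λ i → indicator (suc i ≟ y))

  letters-multiplicity-out : ∀ n y → n < y → letters-multiplicity n y ≡ 0
  letters-multiplicity-out n y n<y = Σ<-zero n h
    where h : ∀ i → i < n → indicator (suc i ≟ y) ≡ 0
          h i i<n = indicator-no (suc i ≟ y) (λ { refl → <-irrefl refl (<-≤-trans i<n (≤-pred n<y)) })

  letters-multiplicity-in : ∀ n y → 1 ≤ y → y ≤ n → letters-multiplicity n y ≡ 1
  letters-multiplicity-in zero y 1≤y y≤0 = ⊥-elim (<-irrefl refl (≤-trans 1≤y y≤0))
  letters-multiplicity-in (suc n) y 1≤y y≤sn with suc n ≟ y
  ... | yes refl = cong (_+ 1) (letters-multiplicity-out n (suc n) (n<1+n n))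
  ... | no ne    = trans (+-identityʳ _) (letters-multiplicity-in n y 1≤y (≤-pred (≤∧≢⇒< y≤sn (λ e → ne (sym e)))))

  letters-multiplicity≢0⇒ : ∀ n y → ¬ (letters-multiplicity n y ≡ 0) → 1 ≤ y × y ≤ n
  letters-multiplicity≢0⇒ zero y h = ⊥-elim (h refl)
  letters-multiplicity≢0⇒ (suc n) y h with suc n ≟ y
  ... | yes refl = s≤s z≤n , ≤-refl
  ... | no ne with letters-multiplicity≢0⇒ n y (λ e → h (trans (+-identityʳ _) e))
  ...   | a , b = a , m≤n⇒m≤1+n b

  word-indicator : ℕ → ℕ → List ℕ → ℕ
  word-indicator n zero [] = 1
  word-indicator n zero (_ ∷ _) = 0
  word-indicator n (suc k) [] = 0
  word-indicator n (suc k) (y ∷ u) = letters-multiplicity n y * word-indicator n k u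

  indicator-≟-∷ : ∀ x w y u → indicator ((x ∷ w) ≟ₗ (y ∷ u)) ≡ indicator (x ≟ y) * indicator (w ≟ₗ u)
  indicator-≟-∷ x w y u = go (x ≟ y) (w ≟ₗ u)
    where
      go : Dec (x ≡ y) → Dec (w ≡ u) → indicator ((x ∷ w) ≟ₗ (y ∷ u)) ≡ indicator (x ≟ y) * indicator (w ≟ₗ u)
      go (yes x≡y) (yes w≡u) = trans (indicator-yes ((x ∷ w) ≟ₗ (y ∷ u)) (cong₂ _∷_ x≡y w≡u))
                                     (sym (cong₂ _*_ (indicator-yes (x ≟ y) x≡y) (indicator-yes (w ≟ₗ u) w≡u)))
      go (yes x≡y) (no w≢u)  = trans (indicator-no ((x ∷ w) ≟ₗ (y ∷ u)) (λ eq → w≢u (∷-injectiveʳ eq)))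
                                     (sym (trans (cong (indicator (x ≟ y) *_) (indicator-no (w ≟ₗ u) w≢u)) (*-zeroʳ (indicator (x ≟ y)))))
      go (no x≢y)  _         = trans (indicator-no ((x ∷ w) ≟ₗ (y ∷ u)) (λ eq → x≢y (∷-injectiveˡ eq)))
                                     (sym (cong (_* indicator (w ≟ₗ u)) (indicator-no (x ≟ y) x≢y)))

  multiplicity-letters : ∀ n y → TN.multiplicity y (letters n) ≡ letters-multiplicity n y
  multiplicity-letters n y = trans (count-map (λ z → z ≟ y) suc (upTo n)) (Σ∈-upTo n _)

  multiplicity-words : ∀ n k v → multiplicity v (words n k) ≡ word-indicator n k v
  multiplicity-words n zero [] = refl
  multiplicity-words n zero (_ ∷ _) = refl
  multiplicity-words n (suc k) v = trans (count-concatMap (λ z → z ≟ₗ v) (λ w → map (_∷ w) (letters n)) (words n k))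
    (trans (Σ∈-cong (words n k) (λ w _ → count-map (λ z → z ≟ₗ v) (_∷ w) (letters n))) (go v))
    where
      go : ∀ v → Σ∈ (words n k) (λ w → Σ∈ (letters n) (λ x → indicator ((x ∷ w) ≟ₗ v))) ≡ word-indicator n (suc k) v
      go [] = Σ∈-zero (words n k) (λ w _ → Σ∈-zero (letters n) (λ x _ → refl))
      go (y ∷ u) = begin
          Σ∈ (words n k) (λ w → Σ∈ (letters n) (λ x → indicator ((x ∷ w) ≟ₗ (y ∷ u))))
        ≡⟨ Σ∈-cong (words n k) (λ w _ → begin
             Σ∈ (letters n) (λ x → indicator ((x ∷ w) ≟ₗ (y ∷ u)))
               ≡⟨ Σ∈-cong (letters n) (λ x _ → trans (indicator-≟-∷ x w y u) (*-comm (indicator (x ≟ y)) (indicator (w ≟ₗ u)))) ⟩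
             Σ∈ (letters n) (λ x → indicator (w ≟ₗ u) * indicator (x ≟ y))
               ≡⟨ Σ∈-*ˡ (letters n) (indicator (w ≟ₗ u)) _ ⟩
             indicator (w ≟ₗ u) * Σ∈ (letters n) (λ x → indicator (x ≟ y))
               ≡⟨ cong (indicator (w ≟ₗ u) *_) (trans (sym (count≡Σ∈ (_≟ y) (letters n))) (multiplicity-letters n y)) ⟩
             indicator (w ≟ₗ u) * letters-multiplicity n y ∎) ⟩
          Σ∈ (words n k) (λ w → indicator (w ≟ₗ u) * letters-multiplicity n y)
        ≡⟨ trans (Σ∈-cong (words n k) (λ w _ → *-comm _ (letters-multiplicity n y))) (Σ∈-*ˡ (words n k) (letters-multiplicity n y) _) ⟩
          letters-multiplicity n y * Σ∈ (words n k) (λ w → indicator (w ≟ₗ u))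
        ≡⟨ cong (letters-multiplicity n y *_) (trans (sym (count≡Σ∈ (λ z → z ≟ₗ u) (words n k))) (multiplicity-words n k u)) ⟩
          letters-multiplicity n y * word-indicator n k u ∎

  module _ {P : Pred (List ℕ) 0ℓ} (P? : Decidable P) where
    indicator-≟-kept : ∀ x v → P x → indicator (x ≟ₗ v) ≡ indicator (P? v) * indicator (x ≟ₗ v)
    indicator-≟-kept x v px with x ≟ₗ v
    ... | yes refl = sym (cong (_* 1) (indicator-yes (P? x) px))
    ... | no _ = sym (*-zeroʳ (indicator (P? v)))

    indicator-≟-dropped : ∀ x v → ¬ P x → indicator (P? v) * indicator (x ≟ₗ v) ≡ 0
    indicator-≟-dropped x v npx with x ≟ₗ v
    ... | yes refl = cong (_* 1) (indicator-no (P? x) npx)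
    ... | no _ = *-zeroʳ (indicator (P? v))

    multiplicity-filter : ∀ v L → multiplicity v (filter P? L) ≡ indicator (P? v) * multiplicity v L
    multiplicity-filter v [] = sym (*-zeroʳ (indicator (P? v)))
    multiplicity-filter v (x ∷ L) with P? x
    ... | yes px = begin
      multiplicity v (x ∷ filter P? L)
        ≡⟨ count-∷ (_≟ₗ v) x (filter P? L) ⟩
      indicator (x ≟ₗ v) + multiplicity v (filter P? L)
        ≡⟨ cong₂ _+_ (indicator-≟-kept x v px) (multiplicity-filter v L) ⟩
      indicator (P? v) * indicator (x ≟ₗ v) + indicator (P? v) * multiplicity v L
        ≡⟨ *-distribˡ-+ (indicator (P? v)) _ _ ⟨
      indicator (P? v) * (indicator (x ≟ₗ v) + multiplicity v L)
        ≡⟨ cong (indicator (P? v) *_) (count-∷ (_≟ₗ v) x L) ⟨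
      indicator (P? v) * multiplicity v (x ∷ L) ∎
    ... | no ¬px = begin
      multiplicity v (filter P? L)
        ≡⟨ multiplicity-filter v L ⟩
      indicator (P? v) * multiplicity v L
        ≡⟨ cong (_+ indicator (P? v) * multiplicity v L) (indicator-≟-dropped x v ¬px) ⟨
      indicator (P? v) * indicator (x ≟ₗ v) + indicator (P? v) * multiplicity v L
        ≡⟨ *-distribˡ-+ (indicator (P? v)) _ _ ⟨
      indicator (P? v) * (indicator (x ≟ₗ v) + multiplicity v L)
        ≡⟨ cong (indicator (P? v) *_) (count-∷ (_≟ₗ v) x L) ⟨
      indicator (P? v) * multiplicity v (x ∷ L) ∎

  IsWord : ℕ → ℕ → List ℕ → Set
  IsWord n k v = length v ≡ k × All (λ x → 1 ≤ x × x ≤ n) v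

  word-indicator≢0⇒IsWord : ∀ n k v → ¬ (word-indicator n k v ≡ 0) → IsWord n k v
  word-indicator≢0⇒IsWord n zero [] h = refl , []
  word-indicator≢0⇒IsWord n zero (_ ∷ _) h = ⊥-elim (h refl)
  word-indicator≢0⇒IsWord n (suc k) [] h = ⊥-elim (h refl)
  word-indicator≢0⇒IsWord n (suc k) (y ∷ u) h
    with word-indicator≢0⇒IsWord n k u (λ e → h (trans (cong (letters-multiplicity n y *_) e) (*-zeroʳ (letters-multiplicity n y))))
  ... | l , a = cong suc l , letters-multiplicity≢0⇒ n y (λ e → h (cong (_* word-indicator n k u) e)) ∷ a

  IsWord⇒word-indicator≡1 : ∀ n k v → IsWord n k v → word-indicator n k v ≡ 1
  IsWord⇒word-indicator≡1 n zero [] _ = refl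
  IsWord⇒word-indicator≡1 n (suc k) (y ∷ u) (l , (a , b) ∷ al) =
    cong₂ _*_ (letters-multiplicity-in n y a b) (IsWord⇒word-indicator≡1 n k u (suc-injective l , al))

  IsPermutation : ℕ → List ℕ → Set
  IsPermutation n v = Unique v × IsWord n n v

  multiplicity-permutations : ∀ n v → multiplicity v (permutations n) ≡ indicator (unique? v) * word-indicator n n v
  multiplicity-permutations n v = trans (multiplicity-filter unique? v (words n n)) (cong (indicator (unique? v) *_) (multiplicity-words n n v))

  IsPermutation⇒multiplicity≡1 : ∀ n v → IsPermutation n v → multiplicity v (permutations n) ≡ 1
  IsPermutation⇒multiplicity≡1 n v (u , w) = trans (multiplicity-permutations n v) (cong₂ _*_ (indicator-yes (unique? v) u) (IsWord⇒word-indicator≡1 n n v w))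

  ¬IsPermutation⇒multiplicity≡0 : ∀ n v → ¬ IsPermutation n v → multiplicity v (permutations n) ≡ 0
  ¬IsPermutation⇒multiplicity≡0 n v np = helper (unique? v) (word-indicator n n v ≟ 0)
    where
      helper : Dec (Unique v) → Dec (word-indicator n n v ≡ 0) → multiplicity v (permutations n) ≡ 0
      helper (no nu) _ = trans (multiplicity-permutations n v) (cong (_* word-indicator n n v) (indicator-no (unique? v) nu))
      helper (yes u) (yes e) = trans (multiplicity-permutations n v) (trans (cong (indicator (unique? v) *_) e) (*-zeroʳ (indicator (unique? v))))
      helper (yes u) (no ne) = ⊥-elim (np (u , word-indicator≢0⇒IsWord n n v ne))

  ∈permutations⇒IsPermutation : ∀ n v → v ∈ permutations n → IsPermutation n v
  ∈permutations⇒IsPermutation n v v∈ = helper (unique? v)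
    where
      helper : Dec (Unique v) → IsPermutation n v
      helper (no nu) = ⊥-elim (∈⇒multiplicity≢0 v (permutations n) v∈
        (trans (multiplicity-permutations n v) (cong (_* word-indicator n n v) (indicator-no (unique? v) nu))))
      helper (yes u) = u , word-indicator≢0⇒IsWord n n v (λ z → ∈⇒multiplicity≢0 v (permutations n) v∈
        (trans (multiplicity-permutations n v) (cong₂ _*_ (indicator-yes (unique? v) u) z)))




module Insertion where

  open import Data.Nat using (_<_; _≤_; z≤n; s≤s; _≟_)
  open import Data.List using (List; []; _∷_; length)
  open import Data.List.Membership.Propositional using (_∈_)
  open import Data.List.Relation.Unary.Any using (here; there)
  open import Data.List.Relation.Unary.All as All using (All; []; _∷_)
  open import Data.List.Relation.Unary.AllPairs using ([]; _∷_)
  open import Data.List.Relation.Unary.Unique.Propositional using (Unique)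
  open import Relation.Nullary using (yes; no; contradiction)
  open import Relation.Binary.PropositionalEquality

  insert : ℕ → ℕ → List ℕ → List ℕ
  insert zero    x w       = x ∷ w
  insert (suc i) x []      = x ∷ []
  insert (suc i) x (y ∷ w) = y ∷ insert i x w

  delete : ℕ → List ℕ → List ℕ
  delete x []      = []
  delete x (y ∷ w) with y ≟ x
  ... | yes _ = w
  ... | no _  = y ∷ delete x w

  position : ℕ → List ℕ → ℕ
  position x []      = 0
  position x (y ∷ w) with y ≟ x
  ... | yes _ = 0
  ... | no _  = suc (position x w)

  length-insert : ∀ i x w → length (insert i x w) ≡ suc (length w)
  length-insert zero    x w       = refl
  length-insert (suc i) x []      = refl
  length-insert (suc i) x (y ∷ w) = cong suc (length-insert i x w)

  delete-insert : ∀ i x w → All (_≢ x) w → delete x (insert i x w) ≡ w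
  delete-insert zero    x w       _ with x ≟ x
  ... | yes _  = refl
  ... | no x≢x = contradiction refl x≢x
  delete-insert (suc i) x []      _ with x ≟ x
  ... | yes _  = refl
  ... | no x≢x = contradiction refl x≢x
  delete-insert (suc i) x (y ∷ w) (y≢x ∷ w≢x) with y ≟ x
  ... | yes y≡x = contradiction y≡x y≢x
  ... | no _    = cong (y ∷_) (delete-insert i x w w≢x)

  position-insert : ∀ i x w → All (_≢ x) w → i ≤ length w → position x (insert i x w) ≡ i
  position-insert zero    x w       _           _         with x ≟ x
  ... | yes _  = refl
  ... | no x≢x = contradiction refl x≢x
  position-insert (suc i) x (y ∷ w) (y≢x ∷ w≢x) (s≤s i≤∣w∣) with y ≟ x
  ... | yes y≡x = contradiction y≡x y≢x
  ... | no _    = cong suc (position-insert i x w w≢x i≤∣w∣)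

  insert-delete : ∀ x v → x ∈ v → insert (position x v) x (delete x v) ≡ v
  insert-delete x (y ∷ w) x∈v with y ≟ x
  insert-delete x (y ∷ w) x∈v         | yes y≡x = cong (_∷ w) (sym y≡x)
  insert-delete x (y ∷ w) (here x≡y)  | no y≢x  = contradiction (sym x≡y) y≢x
  insert-delete x (y ∷ w) (there x∈w) | no _    = cong (y ∷_) (insert-delete x w x∈w)

  position<length : ∀ x v → x ∈ v → position x v < length v
  position<length x (y ∷ w) x∈v with y ≟ x
  position<length x (y ∷ w) x∈v         | yes _   = s≤s z≤n
  position<length x (y ∷ w) (here x≡y)  | no y≢x  = contradiction (sym x≡y) y≢x
  position<length x (y ∷ w) (there x∈w) | no _    = s≤s (position<length x w x∈w)

  length-delete : ∀ x v → x ∈ v → suc (length (delete x v)) ≡ length v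
  length-delete x (y ∷ w) x∈v with y ≟ x
  length-delete x (y ∷ w) x∈v         | yes _   = refl
  length-delete x (y ∷ w) (here x≡y)  | no y≢x  = contradiction (sym x≡y) y≢x
  length-delete x (y ∷ w) (there x∈w) | no _    = cong suc (length-delete x w x∈w)

  delete-All : ∀ {P : ℕ → Set} x v → All P v → All P (delete x v)
  delete-All x []      []         = []
  delete-All x (y ∷ w) (py ∷ pw) with y ≟ x
  ... | yes _ = pw
  ... | no _  = py ∷ delete-All x w pw

  delete-≢ : ∀ x v → Unique v → All (_≢ x) (delete x v)
  delete-≢ x []      _             = []
  delete-≢ x (y ∷ w) (y∉w ∷ uniq) with y ≟ x
  ... | yes refl = All.map (λ y≢z z≡y → y≢z (sym z≡y)) y∉w
  ... | no y≢x   = y≢x ∷ delete-≢ x w uniq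

  delete-Unique : ∀ x v → Unique v → Unique (delete x v)
  delete-Unique x []      uniq           = uniq
  delete-Unique x (y ∷ w) (y∉w ∷ uniq) with y ≟ x
  ... | yes _ = uniq
  ... | no _  = delete-All x w y∉w ∷ delete-Unique x w uniq

  insert-All : ∀ {P : ℕ → Set} i x w → P x → All P w → All P (insert i x w)
  insert-All zero    x w       px pw         = px ∷ pw
  insert-All (suc i) x []      px []         = px ∷ []
  insert-All (suc i) x (y ∷ w) px (py ∷ pw) = py ∷ insert-All i x w px pw

  insert-Unique : ∀ i x w → Unique w → All (_≢ x) w → Unique (insert i x w)
  insert-Unique zero    x w       uniq         w≢x         = All.map (λ y≢x x≡y → y≢x (sym x≡y)) w≢x ∷ uniq
  insert-Unique (suc i) x []      uniq         _           = [] ∷ []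
  insert-Unique (suc i) x (y ∷ w) (y∉w ∷ uniq) (y≢x ∷ w≢x) = insert-All i x w y≢x y∉w ∷ insert-Unique i x w uniq w≢x


module PermutationInsertion where

  open import Data.Nat using (_<_; _≤_; z≤n; s≤s; _≟_; _≤?_)
  open import Data.Nat.Properties using (<-irrefl; ≤-pred; ≤-trans; ≤∧≢⇒<; ≤-refl; m≤n⇒m≤1+n; suc-injective)
  open import Data.List using (List; []; _∷_; map; concatMap; length; upTo)
  open import Data.List.Membership.Propositional using (_∈_)
  open import Data.List.Membership.DecPropositional _≟_ using (_∈?_)
  open import Data.List.Relation.Unary.Any using (here; there)
  open import Data.List.Relation.Unary.All as All using (All; []; _∷_)
  open import Data.List.Relation.Unary.Unique.DecPropositional _≟_ using (Unique; unique?)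
  open import Data.Product using (_,_; _×_; proj₁; proj₂)
  open import Data.Empty using (⊥-elim)
  open import Level using (0ℓ)
  open import Relation.Nullary using (Dec; yes; no; ¬_)
  open import Relation.Nullary.Decidable using (_×-dec_)
  open import Relation.Unary using (Pred; Decidable)
  open import Relation.Binary.PropositionalEquality
  open Defs using (permutations)
  open Counting
  open Permutations
  open Insertion
  open ℕΣ using (Σ<; Σ<-cong; Σ<-zero)

  ∉⇒All≢ : ∀ (M : ℕ) (v : List ℕ) → ¬ (M ∈ v) → All (_≢ M) v
  ∉⇒All≢ M [] _ = []
  ∉⇒All≢ M (y ∷ v) h = (λ e → h (here (sym e))) ∷ ∉⇒All≢ M v (λ m → h (there m))

  range-shrink : ∀ n v → All (λ x → 1 ≤ x × x ≤ suc n) v → All (_≢ suc n) v → All (λ x → 1 ≤ x × x ≤ n) v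
  range-shrink n [] _ _ = []
  range-shrink n (y ∷ v) ((a , b) ∷ r) (ne ∷ r') = (a , ≤-pred (≤∧≢⇒< b ne)) ∷ range-shrink n v r r'

  pigeonhole : ∀ n v → Unique v → All (λ x → 1 ≤ x × x ≤ n) v → length v ≤ n
  pigeonhole zero [] _ _ = z≤n
  pigeonhole zero (y ∷ v) _ ((a , b) ∷ _) = ⊥-elim (<-irrefl refl (≤-trans a b))
  pigeonhole (suc n) v u a with suc n ∈? v
  ... | yes m = subst (_≤ suc n) (length-delete (suc n) v m)
    (s≤s (pigeonhole n (delete (suc n) v) (delete-Unique (suc n) v u)
                       (range-shrink n (delete (suc n) v) (delete-All (suc n) v a) (delete-≢ (suc n) v u))))
  ... | no nm = m≤n⇒m≤1+n (pigeonhole n v u (range-shrink n v a (∉⇒All≢ (suc n) v nm)))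

  IsPermutation-delete : ∀ n v → IsPermutation (suc n) v → (suc n ∈ v) × IsPermutation n (delete (suc n) v)
  IsPermutation-delete n v (u , l , a) with suc n ∈? v
  ... | no nm = ⊥-elim (<-irrefl refl (subst (_≤ n) l (pigeonhole n v u (range-shrink n v a (∉⇒All≢ (suc n) v nm)))))
  ... | yes m = m , delete-Unique (suc n) v u , suc-injective (trans (length-delete (suc n) v m) l)
                  , range-shrink n (delete (suc n) v) (delete-All (suc n) v a) (delete-≢ (suc n) v u)

  range-weaken : ∀ n w → All (λ x → 1 ≤ x × x ≤ n) w → All (λ x → 1 ≤ x × x ≤ suc n) w
  range-weaken n w = All.map (λ {x} (ab : 1 ≤ x × x ≤ n) → proj₁ ab , m≤n⇒m≤1+n (proj₂ ab))

  range⇒All≢ : ∀ n w → All (λ x → 1 ≤ x × x ≤ n) w → All (_≢ suc n) w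
  range⇒All≢ n w = All.map (λ {x} (ab : 1 ≤ x × x ≤ n) e → <-irrefl e (s≤s (proj₂ ab)))

  IsPermutation-insert : ∀ n w i → IsPermutation n w → IsPermutation (suc n) (insert i (suc n) w)
  IsPermutation-insert n w i (u , l , a) =
    insert-Unique i (suc n) w u (range⇒All≢ n w a) , trans (length-insert i (suc n) w) (cong suc l)
    , insert-All i (suc n) w (s≤s z≤n , ≤-refl) (range-weaken n w a)

  isPermutation? : ∀ n v → Dec (IsPermutation n v)
  isPermutation? n v = unique? v ×-dec ((length v ≟ n) ×-dec All.all? (λ x → (1 ≤? x) ×-dec (x ≤? n)) v)

  insertions : ℕ → List (List ℕ)
  insertions n = concatMap (λ w → map (λ i → insert i (suc n) w) (upTo (suc n))) (permutations n)

  -- Inserting n+1 into w can give v at one place at most: the position of n+1 in v.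
  Σ-indicator-insert : ∀ n v w → IsPermutation (suc n) v → IsPermutation n w →
    Σ< (suc n) (λ i → indicator (insert i (suc n) w ≟ₗ v)) ≡ indicator (w ≟ₗ delete (suc n) v)
  Σ-indicator-insert n v w pv (_ , lw , aw) = go (w ≟ₗ delete (suc n) v)
    where
      M = suc n
      m = proj₁ (IsPermutation-delete n v pv)
      go : Dec (w ≡ delete M v) → Σ< (suc n) (λ i → indicator (insert i M w ≟ₗ v)) ≡ indicator (w ≟ₗ delete M v)
      go (yes e) = trans (Σ<-cong (suc n) term)
        (trans (letters-multiplicity-in (suc n) (suc (position M v)) (s≤s z≤n)
                  (subst (λ z → position M v < z) (proj₁ (proj₂ pv)) (position<length M v m)))
               (sym (indicator-yes (w ≟ₗ delete M v) e)))
        where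
          term : ∀ i → i < suc n → indicator (insert i M w ≟ₗ v) ≡ indicator (suc i ≟ suc (position M v))
          term i i<sn with i ≟ position M v
          ... | yes refl = trans (indicator-yes (insert i M w ≟ₗ v) (trans (cong (insert i M) e) (insert-delete M v m))) (sym (indicator-yes (suc i ≟ suc i) refl))
          ... | no ne = trans (indicator-no (insert i M w ≟ₗ v) (λ q → ne (trans
                          (sym (position-insert i M w (range⇒All≢ n w aw) (subst (i ≤_) (sym lw) (≤-pred i<sn))))
                          (cong (position M) q))))
                          (sym (indicator-no (suc i ≟ suc (position M v)) (λ q → ne (suc-injective q))))
      go (no ne) = trans
        (Σ<-zero (suc n) (λ i _ → indicator-no (insert i M w ≟ₗ v)
          (λ q → ne (trans (sym (delete-insert i M w (range⇒All≢ n w aw))) (cong (delete M) q)))))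
        (sym (indicator-no (w ≟ₗ delete M v) ne))

  count-insertions : ∀ n {P : Pred (List ℕ) 0ℓ} (P? : Decidable P) →
    count P? (insertions n) ≡ Σ∈ (permutations n) (λ w → Σ< (suc n) (λ i → indicator (P? (insert i (suc n) w))))
  count-insertions n P? = trans (count-concatMap P? (λ w → map (λ i → insert i (suc n) w) (upTo (suc n))) (permutations n))
    (Σ∈-cong (permutations n) (λ w _ → trans (count-map P? (λ i → insert i (suc n) w) (upTo (suc n))) (Σ∈-upTo (suc n) _)))

  multiplicity-insertions : ∀ n v → multiplicity v (insertions n) ≡ multiplicity v (permutations (suc n))
  multiplicity-insertions n v = trans (count-insertions n (λ z → z ≟ₗ v)) (go (isPermutation? (suc n) v))
    where
      go : Dec (IsPermutation (suc n) v) →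
           Σ∈ (permutations n) (λ w → Σ< (suc n) (λ i → indicator (insert i (suc n) w ≟ₗ v))) ≡ multiplicity v (permutations (suc n))
      go (yes pv) = trans (Σ∈-cong (permutations n) (λ w w∈ → Σ-indicator-insert n v w pv (∈permutations⇒IsPermutation n w w∈)))
                     (trans (sym (count≡Σ∈ (λ z → z ≟ₗ delete (suc n) v) (permutations n)))
                       (trans (IsPermutation⇒multiplicity≡1 n (delete (suc n) v) (proj₂ (IsPermutation-delete n v pv)))
                              (sym (IsPermutation⇒multiplicity≡1 (suc n) v pv))))
      go (no npv) = trans (Σ∈-zero (permutations n) (λ w w∈ → Σ<-zero (suc n) (λ i _ → indicator-no (insert i (suc n) w ≟ₗ v)
                        (λ q → npv (subst (IsPermutation (suc n)) q (IsPermutation-insert n w i (∈permutations⇒IsPermutation n w w∈)))))))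
                      (sym (¬IsPermutation⇒multiplicity≡0 (suc n) v npv))

  count-permutations-suc : ∀ n {P : Pred (List ℕ) 0ℓ} (P? : Decidable P) →
    count P? (permutations (suc n)) ≡ Σ∈ (permutations n) (λ w → Σ< (suc n) (λ i → indicator (P? (insert i (suc n) w))))
  count-permutations-suc n P? = trans (sym (count-cong-multiplicity (insertions n) (permutations (suc n)) (multiplicity-insertions n) P?)) (count-insertions n P?)




module Ascents where

  open import Data.Nat using (_+_; _*_; _∸_; _<_; _≤_; z≤n; s≤s; _<ᵇ_; _≟_)
  open import Data.Nat.Properties
    using (<⇒<ᵇ; <ᵇ⇒<; <-asym; +-identityʳ; *-identityˡ; +-comm; +-assoc; +-suc; ≤-refl; ≤-pred; m<n⇒m<1+n; n<1+n; m∸n+n≡m; m+n∸n≡m)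
  open import Data.Nat.Tactic.RingSolver using (solve-∀)
  open import Data.Bool using (true; false; if_then_else_; T)
  open import Data.Unit using (tt)
  open import Data.Sum using (_⊎_; inj₁; inj₂)
  open import Data.List using (List; []; _∷_; length)
  open import Data.List.Relation.Unary.All using (All; []; _∷_)
  open import Relation.Nullary using (yes; no; contradiction)
  open import Relation.Binary.PropositionalEquality
  open Defs using (ascents)
  open Insertion
  open Counting using (indicator)
  open ℕΣ using (Σ<; Σ<-shift; Σ<-cong; Σ<-+; Σ<-*ʳ)

  leading-ascent : ℕ → List ℕ → ℕ
  leading-ascent y [] = 0
  leading-ascent y (z ∷ _) = if y <ᵇ z then 1 else 0

  ascents-∷ : ∀ y w → ascents (y ∷ w) ≡ leading-ascent y w + ascents w
  ascents-∷ y [] = refl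
  ascents-∷ y (z ∷ w) = refl

  ascent-gain : ℕ → List ℕ → ℕ
  ascent-gain zero w = 0
  ascent-gain (suc i) [] = 0
  ascent-gain (suc zero) (y ∷ w) = 1 ∸ leading-ascent y w
  ascent-gain (suc (suc i)) (y ∷ w) = ascent-gain (suc i) w

  leading-ascent-binary : ∀ y w → leading-ascent y w ≡ 0 ⊎ leading-ascent y w ≡ 1
  leading-ascent-binary y [] = inj₁ refl
  leading-ascent-binary y (z ∷ w) with y <ᵇ z
  ... | true = inj₂ refl
  ... | false = inj₁ refl

  private
    <⇒<ᵇ≡true : ∀ {y M} → y < M → (y <ᵇ M) ≡ true
    <⇒<ᵇ≡true {y} {M} y<M with y <ᵇ M in eq
    ... | true  = refl
    ... | false = contradiction (subst T eq (<⇒<ᵇ y<M)) (λ ())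

    <⇒>ᵇ≡false : ∀ {y M} → y < M → (M <ᵇ y) ≡ false
    <⇒>ᵇ≡false {y} {M} y<M with M <ᵇ y in eq
    ... | true  = contradiction (<ᵇ⇒< M y (subst T (sym eq) tt)) (<-asym y<M)
    ... | false = refl

  leading-ascent-max : ∀ M w → All (_< M) w → leading-ascent M w ≡ 0
  leading-ascent-max M [] _ = refl
  leading-ascent-max M (z ∷ w) (z<M ∷ _) rewrite <⇒>ᵇ≡false z<M = refl

  ascent-gain-binary : ∀ i w → ascent-gain i w ≡ 0 ⊎ ascent-gain i w ≡ 1
  ascent-gain-binary zero w = inj₁ refl
  ascent-gain-binary (suc i) [] = inj₁ refl
  ascent-gain-binary (suc zero) (y ∷ w) with leading-ascent-binary y w
  ... | inj₁ e rewrite e = inj₂ refl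
  ... | inj₂ e rewrite e = inj₁ refl
  ascent-gain-binary (suc (suc i)) (y ∷ w) = ascent-gain-binary (suc i) w

  ascents-insert : ∀ i M w → All (_< M) w → i ≤ length w → ascents (insert i M w) ≡ ascents w + ascent-gain i w
  ascents-insert zero M w a _ = trans (ascents-∷ M w) (trans (cong (_+ ascents w) (leading-ascent-max M w a)) (sym (+-identityʳ _)))
  ascents-insert (suc zero) M (y ∷ w) (y<M ∷ a) _
    rewrite <⇒<ᵇ≡true y<M | ascents-∷ M w | leading-ascent-max M w a | ascents-∷ y w
    with leading-ascent-binary y w
  ... | inj₁ e rewrite e = +-comm 1 (ascents w)
  ... | inj₂ e rewrite e = cong suc (sym (+-identityʳ (ascents w)))
  ascents-insert (suc (suc i)) M (y ∷ z ∷ w) (y<M ∷ a) (s≤s i≤) =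
    trans (cong ((if y <ᵇ z then 1 else 0) +_) (ascents-insert (suc i) M (z ∷ w) a i≤)) (sym (+-assoc (if y <ᵇ z then 1 else 0) _ _))

  no-gain : List ℕ → ℕ → ℕ
  no-gain w i = indicator (ascent-gain i w ≟ 0)

  indicator-1∸leading-ascent : ∀ y w → indicator ((1 ∸ leading-ascent y w) ≟ 0) ≡ leading-ascent y w
  indicator-1∸leading-ascent y w with leading-ascent-binary y w
  ... | inj₁ e rewrite e = refl
  ... | inj₂ e rewrite e = refl

  Σ-no-gain : ∀ w → Σ< (suc (length w)) (no-gain w) ≡ suc (ascents w)
  Σ-no-gain [] = refl
  Σ-no-gain (y ∷ w) = begin
      Σ< (suc (suc L)) (no-gain (y ∷ w))
    ≡⟨ Σ<-shift (suc L) _ ⟩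
      1 + Σ< (suc L) (λ i → no-gain (y ∷ w) (suc i))
    ≡⟨ cong (1 +_) (Σ<-shift L _) ⟩
      1 + (indicator ((1 ∸ leading-ascent y w) ≟ 0) + Σ< L (λ i → no-gain w (suc i)))
    ≡⟨ cong (λ z → 1 + (z + Σ< L (λ i → no-gain w (suc i)))) (indicator-1∸leading-ascent y w) ⟩
      1 + (leading-ascent y w + Σ< L (λ i → no-gain w (suc i)))
    ≡⟨ +-suc (leading-ascent y w) _ ⟨
      leading-ascent y w + (1 + Σ< L (λ i → no-gain w (suc i)))
    ≡⟨ cong (leading-ascent y w +_) (sym (Σ<-shift L (no-gain w))) ⟩
      leading-ascent y w + Σ< (suc L) (no-gain w)
    ≡⟨ cong (leading-ascent y w +_) (Σ-no-gain w) ⟩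
      leading-ascent y w + suc (ascents w)
    ≡⟨ +-suc (leading-ascent y w) (ascents w) ⟩
      suc (leading-ascent y w + ascents w)
    ≡⟨ cong suc (sym (ascents-∷ y w)) ⟩
      suc (ascents (y ∷ w)) ∎
    where
      open ≡-Reasoning
      L = length w

  Σ<-complement : ∀ n f → (∀ i → i < n → f i ≤ 1) → Σ< n (λ i → 1 ∸ f i) + Σ< n f ≡ n
  Σ<-complement zero    f f≤1 = refl
  Σ<-complement (suc n) f f≤1 = trans (interchange (Σ< n (λ i → 1 ∸ f i)) (Σ< n f) (1 ∸ f n) (f n))
    (trans (cong₂ _+_ (Σ<-complement n f (λ i i<n → f≤1 i (m<n⇒m<1+n i<n))) (m∸n+n≡m (f≤1 n (n<1+n n)))) (+-comm n 1))
    where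
      interchange : ∀ a b c d → a + c + (b + d) ≡ (a + b) + (c + d)
      interchange = solve-∀

  indicator-+-binary : ∀ a d k → d ≡ 0 ⊎ d ≡ 1 →
    indicator ((a + d) ≟ k) ≡ indicator (d ≟ 0) * indicator (a ≟ k) + (1 ∸ indicator (d ≟ 0)) * indicator (suc a ≟ k)
  indicator-+-binary a d k (inj₁ refl) =
    trans (cong (λ z → indicator (z ≟ k)) (+-identityʳ a)) (sym (trans (+-identityʳ _) (*-identityˡ _)))
  indicator-+-binary a d k (inj₂ refl) =
    trans (cong (λ z → indicator (z ≟ k)) (+-comm a 1)) (sym (*-identityˡ _))

  no-gain≤1 : ∀ w i → no-gain w i ≤ 1
  no-gain≤1 w i with ascent-gain i w ≟ 0
  ... | yes _ = ≤-refl
  ... | no _  = z≤n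

  count-insertions-by-ascents : ∀ n M w k → All (_< M) w → length w ≡ n →
    Σ< (suc n) (λ i → indicator (ascents (insert i M w) ≟ k))
      ≡ suc (ascents w) * indicator (ascents w ≟ k) + (n ∸ ascents w) * indicator (suc (ascents w) ≟ k)
  count-insertions-by-ascents n M w k a lw = begin
      Σ< (suc n) (λ i → indicator (ascents (insert i M w) ≟ k))
    ≡⟨ Σ<-cong (suc n) (λ i i<sn → trans (cong (λ z → indicator (z ≟ k)) (ascents-insert i M w a (subst (i ≤_) (sym lw) (≤-pred i<sn))))
                                         (indicator-+-binary A (ascent-gain i w) k (ascent-gain-binary i w))) ⟩
      Σ< (suc n) (λ i → no-gain w i * X + (1 ∸ no-gain w i) * Y)
    ≡⟨ Σ<-+ (suc n) _ _ ⟩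
      Σ< (suc n) (λ i → no-gain w i * X) + Σ< (suc n) (λ i → (1 ∸ no-gain w i) * Y)
    ≡⟨ cong₂ _+_ (Σ<-*ʳ (suc n) X (no-gain w)) (Σ<-*ʳ (suc n) Y (λ i → 1 ∸ no-gain w i)) ⟩
      Σ< (suc n) (no-gain w) * X + Σ< (suc n) (λ i → 1 ∸ no-gain w i) * Y
    ≡⟨ cong₂ (λ u v → u * X + v * Y) no-gains gains ⟩
      suc A * X + (n ∸ A) * Y ∎
    where
      open ≡-Reasoning
      A = ascents w
      X = indicator (A ≟ k)
      Y = indicator (suc A ≟ k)
      no-gains : Σ< (suc n) (no-gain w) ≡ suc A
      no-gains = subst (λ z → Σ< (suc z) (no-gain w) ≡ suc A) lw (Σ-no-gain w)
      gains : Σ< (suc n) (λ i → 1 ∸ no-gain w i) ≡ n ∸ A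
      gains = trans (sym (m+n∸n≡m _ (Σ< (suc n) (no-gain w))))
                    (cong₂ _∸_ (Σ<-complement (suc n) (no-gain w) (λ i _ → no-gain≤1 w i)) no-gains)




module AscentCount where

  open import Data.Nat using (_+_; _*_; _∸_; _<_; s≤s; _≟_)
  open import Data.Nat.Properties using (*-zeroʳ; +-identityʳ; suc-injective)
  open import Data.List.Relation.Unary.All as All using (All)
  open import Data.Product using (_,_; proj₁; proj₂)
  open import Relation.Nullary using (yes; no; contradiction)
  open import Relation.Binary.PropositionalEquality
  open Defs using (ascents; permutations)
  open Counting
  open Permutations
  open PermutationInsertion
  open Ascents
  open Eulerian using (eulerian)

  ascent-count : ℕ → ℕ → ℕ
  ascent-count n k = count (λ w → ascents w ≟ k) (permutations n)

  private
    indicator-subst : ∀ (g : ℕ → ℕ) a j → g a * indicator (a ≟ j) ≡ g j * indicator (a ≟ j)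
    indicator-subst g a j with a ≟ j
    ... | yes refl = refl
    ... | no _     = trans (*-zeroʳ (g a)) (sym (*-zeroʳ (g j)))

    below-max : ∀ {n w} → IsPermutation n w → All (_< suc n) w
    below-max (_ , _ , in-range) = All.map (λ 1≤x≤n → s≤s (proj₂ 1≤x≤n)) in-range

    indicator-suc : ∀ a b → indicator (suc a ≟ suc b) ≡ indicator (a ≟ b)
    indicator-suc a b with a ≟ b | suc a ≟ suc b
    ... | yes _  | yes _  = refl
    ... | no _   | no _   = refl
    ... | yes eq | no neq = contradiction (cong suc eq) neq
    ... | no neq | yes eq = contradiction (suc-injective eq) neq

    Σ∈-count : ∀ n k (g : ℕ → ℕ) →
      Σ∈ (permutations n) (λ w → g (ascents w) * indicator (ascents w ≟ k)) ≡ g k * ascent-count n k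
    Σ∈-count n k g = begin
      Σ∈ (permutations n) (λ w → g (ascents w) * indicator (ascents w ≟ k))
        ≡⟨ Σ∈-cong (permutations n) (λ w _ → indicator-subst g (ascents w) k) ⟩
      Σ∈ (permutations n) (λ w → g k * indicator (ascents w ≟ k))
        ≡⟨ Σ∈-*ˡ (permutations n) (g k) _ ⟩
      g k * Σ∈ (permutations n) (λ w → indicator (ascents w ≟ k))
        ≡⟨ cong (g k *_) (count≡Σ∈ (λ w → ascents w ≟ k) (permutations n)) ⟨
      g k * ascent-count n k ∎
      where open ≡-Reasoning

  -- Inserting n+1 into a permutation with a ascents gives a ascents at a+1 places and a+1 at the other n−a.
  ascent-count-suc : ∀ n k → ascent-count (suc n) k ≡
    Σ∈ (permutations n) (λ w → suc (ascents w) * indicator (ascents w ≟ k) + (n ∸ ascents w) * indicator (suc (ascents w) ≟ k))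
  ascent-count-suc n k = trans (count-permutations-suc n (λ w → ascents w ≟ k))
    (Σ∈-cong (permutations n) (λ w w∈ → let perm = ∈permutations⇒IsPermutation n w w∈ in
      count-insertions-by-ascents n (suc n) w k (below-max perm) (proj₁ (proj₂ perm))))

  ascent-count≡eulerian : ∀ n k → ascent-count n k ≡ eulerian n k
  ascent-count≡eulerian zero    zero    = refl
  ascent-count≡eulerian zero    (suc k) = refl
  ascent-count≡eulerian (suc n) zero    = begin
    ascent-count (suc n) 0
      ≡⟨ ascent-count-suc n 0 ⟩
    Σ∈ (permutations n) (λ w → suc (ascents w) * indicator (ascents w ≟ 0) + (n ∸ ascents w) * 0)
      ≡⟨ Σ∈-cong (permutations n) (λ w _ → trans (cong (suc (ascents w) * indicator (ascents w ≟ 0) +_) (*-zeroʳ (n ∸ ascents w))) (+-identityʳ _)) ⟩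
    Σ∈ (permutations n) (λ w → suc (ascents w) * indicator (ascents w ≟ 0))
      ≡⟨ Σ∈-count n 0 suc ⟩
    1 * ascent-count n 0
      ≡⟨ cong (1 *_) (ascent-count≡eulerian n 0) ⟩
    1 * eulerian n 0
      ≡⟨ +-identityʳ _ ⟩
    eulerian n 0 ∎
    where open ≡-Reasoning
  ascent-count≡eulerian (suc n) (suc k) = begin
    ascent-count (suc n) (suc k)
      ≡⟨ ascent-count-suc n (suc k) ⟩
    Σ∈ (permutations n) (λ w → suc (ascents w) * indicator (ascents w ≟ suc k) + (n ∸ ascents w) * indicator (suc (ascents w) ≟ suc k))
      ≡⟨ Σ∈-cong (permutations n) (λ w _ →
           cong (λ i → suc (ascents w) * indicator (ascents w ≟ suc k) + (n ∸ ascents w) * i) (indicator-suc (ascents w) k)) ⟩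
    Σ∈ (permutations n) (λ w → suc (ascents w) * indicator (ascents w ≟ suc k) + (n ∸ ascents w) * indicator (ascents w ≟ k))
      ≡⟨ Σ∈-+ (permutations n) _ _ ⟩
    Σ∈ (permutations n) (λ w → suc (ascents w) * indicator (ascents w ≟ suc k)) + Σ∈ (permutations n) (λ w → (n ∸ ascents w) * indicator (ascents w ≟ k))
      ≡⟨ cong₂ _+_ (Σ∈-count n (suc k) suc) (Σ∈-count n k (n ∸_)) ⟩
    suc (suc k) * ascent-count n (suc k) + (n ∸ k) * ascent-count n k
      ≡⟨ cong₂ (λ a b → suc (suc k) * a + (n ∸ k) * b) (ascent-count≡eulerian n (suc k)) (ascent-count≡eulerian n k) ⟩
    eulerian (suc n) (suc k) ∎
    where open ≡-Reasoning


module EvenAscents where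

  open import Data.Nat using (_+_; _%_; _<_; _≤_; z≤n; s≤s; _<ᵇ_; _≟_; _<?_; pred)
  open import Data.Nat.Properties
    using (+-mono-≤; ≤-refl; ≤-trans; n≤1+n; +-identityʳ; <-irrefl; ≮⇒≥; m≤n⇒m<n∨m≡n; <-≤-trans; n<1+n; 1+n≢0)
  open import Data.Bool using (true; false; if_then_else_)
  open import Data.List using (List; []; _∷_; length)
  open import Data.Product using (proj₁; proj₂)
  open import Data.Sum using (inj₁; inj₂)
  open import Relation.Nullary using (yes; no; contradiction)
  open import Relation.Binary.PropositionalEquality
  open Defs using (ascents; permutations; N)
  open DoubleProperties using (double-mono-<; double%2≡0; suc-double%2≡1)
  open Counting
  open Permutations using (∈permutations⇒IsPermutation)
  open import Data.List.Membership.Propositional using (_∈_)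
  open AscentCount using (ascent-count)
  open ℕΣ using (Σ<; Σ<-cong; Σ<-zero)

  ascents≤ : ∀ w → ascents w ≤ pred (length w)
  ascents≤ []          = z≤n
  ascents≤ (y ∷ [])    = z≤n
  ascents≤ (y ∷ z ∷ w) = +-mono-≤ (indicator≤1 (y <ᵇ z)) (ascents≤ (z ∷ w))
    where
      indicator≤1 : ∀ b → (if b then 1 else 0) ≤ 1
      indicator≤1 true  = ≤-refl
      indicator≤1 false = z≤n

  Σ<-Σ∈-comm : ∀ {A : Set} m (xs : List A) (f : ℕ → A → ℕ) → Σ< m (λ t → Σ∈ xs (f t)) ≡ Σ∈ xs (λ x → Σ< m (λ t → f t x))
  Σ<-Σ∈-comm zero    xs f = sym (Σ∈-zero xs (λ _ _ → refl))
  Σ<-Σ∈-comm (suc m) xs f = trans (cong (_+ Σ∈ xs (f m)) (Σ<-Σ∈-comm m xs f)) (sym (Σ∈-+ xs _ _))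

  Σ-indicator-double : ∀ m a → a < double m → Σ< m (λ t → indicator (a ≟ double t)) ≡ indicator (a % 2 ≟ 0)
  Σ-indicator-double (suc m) a a<2m+2 with a <? double m
  ... | yes a<2m = trans (cong₂ _+_ (Σ-indicator-double m a a<2m) (indicator-no (a ≟ double m) (λ a≡2m → <-irrefl a≡2m a<2m))) (+-identityʳ _)
  ... | no a≮2m  = trans (cong (_+ indicator (a ≟ double m)) earlier≡0) (last (≮⇒≥ a≮2m))
    where
      earlier≡0 : Σ< m (λ t → indicator (a ≟ double t)) ≡ 0
      earlier≡0 = Σ<-zero m (λ t t<m → indicator-no (a ≟ double t) (λ a≡2t → a≮2m (subst (_< double m) (sym a≡2t) (double-mono-< t<m))))
      last : double m ≤ a → indicator (a ≟ double m) ≡ indicator (a % 2 ≟ 0)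
      last 2m≤a with m≤n⇒m<n∨m≡n 2m≤a
      ... | inj₂ refl = trans (indicator-yes (double m ≟ double m) refl) (sym (indicator-yes (double m % 2 ≟ 0) (double%2≡0 m)))
      ... | inj₁ 2m<a with m≤n⇒m<n∨m≡n 2m<a
      ...   | inj₁ 2m+1<a = contradiction (<-≤-trans a<2m+2 2m+1<a) (<-irrefl refl)
      ...   | inj₂ refl   = trans (indicator-no (suc (double m) ≟ double m) (λ eq → <-irrefl (sym eq) (n<1+n (double m))))
                                  (sym (indicator-no (suc (double m) % 2 ≟ 0) (λ eq → 1+n≢0 (trans (sym (suc-double%2≡1 m)) eq))))

  N≡Σ-ascent-count-even : ∀ m′ → N (suc (double m′)) ≡ Σ< (suc m′) (λ t → ascent-count (suc (double m′)) (double t))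
  N≡Σ-ascent-count-even m′ = begin
    N n
      ≡⟨ count≡Σ∈ (λ w → ascents w % 2 ≟ 0) (permutations n) ⟩
    Σ∈ (permutations n) (λ w → indicator (ascents w % 2 ≟ 0))
      ≡⟨ Σ∈-cong (permutations n) (λ w w∈ → sym (Σ-indicator-double (suc m′) (ascents w) (bound w w∈))) ⟩
    Σ∈ (permutations n) (λ w → Σ< (suc m′) (λ t → indicator (ascents w ≟ double t)))
      ≡⟨ Σ<-Σ∈-comm (suc m′) (permutations n) (λ t w → indicator (ascents w ≟ double t)) ⟨
    Σ< (suc m′) (λ t → Σ∈ (permutations n) (λ w → indicator (ascents w ≟ double t)))
      ≡⟨ Σ<-cong (suc m′) (λ t _ → sym (count≡Σ∈ (λ w → ascents w ≟ double t) (permutations n))) ⟩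
    Σ< (suc m′) (λ t → ascent-count n (double t)) ∎
    where
      open ≡-Reasoning
      n = suc (double m′)
      bound : ∀ w → w ∈ permutations n → ascents w < double (suc m′)
      bound w w∈ = s≤s (≤-trans (subst (λ l → ascents w ≤ pred l) (proj₁ (proj₂ (∈permutations⇒IsPermutation n w w∈))) (ascents≤ w))
                                (n≤1+n (double m′)))


module WieferichCriteria (m′ : ℕ) (p-prime : Data.Nat.Primality.Prime (suc (double (suc m′)))) where

  open import Data.Nat using (_*_; _%_; _∸_)
  open import Data.Integer as ℤ using (+_; +0)
  open import Function using (_⇔_; mk⇔)
  import Function.Properties.Equivalence as ⇔
  open import Relation.Binary.PropositionalEquality hiding (setoid)
  open Defs using (Wieferich; N; H′; ResidueZero; oddHarmonic)
  open OddPrime m′ p-prime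
  open FermatQuotient m′ p-prime using (q≈H)
  open EulerianModP m′ p-prime using (even-eulerian-sum; 2*even-eulerian-sum≈1+H)
  open OddHarmonicResidue m′ p-prime using (ResidueZero⇔H≈0)

  wieferich⇔H≈0 : Wieferich p ⇔ H ≈ +0
  wieferich⇔H≈0 = mk⇔ (λ p∣q → ≈-trans (≈-sym q≈H) (∣⇒≈0 p∣q)) (λ H≈0 → ≈0⇒∣ (≈-trans q≈H H≈0))

  N≡even-eulerian-sum : N (p ∸ 2) ≡ even-eulerian-sum
  N≡even-eulerian-sum = trans (EvenAscents.N≡Σ-ascent-count-even m′)
    (ℕΣ.Σ<-cong m (λ t _ → AscentCount.ascent-count≡eulerian (suc (double m′)) (double t)))

  2N%p≡1⇔H≈0 : ((2 * N (p ∸ 2)) % p ≡ 1) ⇔ H ≈ +0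
  2N%p≡1⇔H≈0 = ⇔.trans (%≡1⇔≈1 (2 * N (p ∸ 2))) (mk⇔
    (λ 2N≈1 → +-cancelˡ-≈ {+ 1} (≈-trans (≈-sym 2N≈1+H) 2N≈1))
    (λ H≈0 → ≈-trans 2N≈1+H (+-cong (≈-refl {+ 1}) H≈0)))
    where
      2N≈1+H : + (2 * N (p ∸ 2)) ≈ + 1 ℤ.+ H
      2N≈1+H = subst (λ n → + (2 * n) ≈ + 1 ℤ.+ H) (sym N≡even-eulerian-sum) 2*even-eulerian-sum≈1+H

  residue⇔H≈0 : ResidueZero p (H′ p) ⇔ H ≈ +0
  residue⇔H≈0 = subst (λ k → ResidueZero p (oddHarmonic k) ⇔ H ≈ +0) (sym (DoubleProperties.double[n]/2≡n m)) ResidueZero⇔H≈0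


module OddPrimes where

  open import Data.Nat using (nonTrivial⇒n>1)
  open import Data.Nat.Properties using (<-irrefl; *-comm)
  open import Data.Nat.Divisibility using (divides)
  open import Data.Nat.Primality using (Prime; prime⇒irreducible; prime⇒nonTrivial)
  open import Data.Product using (∃; _,_)
  open import Data.Sum using (_⊎_; inj₁; inj₂)
  open import Relation.Nullary using (contradiction)
  open import Relation.Binary.PropositionalEquality

  even-or-odd : ∀ n → ∃ (λ k → n ≡ double k) ⊎ ∃ (λ k → n ≡ suc (double k))
  even-or-odd zero    = inj₁ (0 , refl)
  even-or-odd (suc n) with even-or-odd n
  ... | inj₁ (k , n≡2k)   = inj₂ (k , cong suc n≡2k)
  ... | inj₂ (k , n≡2k+1) = inj₁ (suc k , cong suc n≡2k+1)

  odd-prime : ∀ {p} → Prime p → p ≢ 2 → ∃ λ m′ → p ≡ suc (double (suc m′))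
  odd-prime {p} p-prime p≢2 with even-or-odd p
  ... | inj₂ (suc m′ , p≡2m+3) = m′ , p≡2m+3
  ... | inj₂ (zero , refl)     = contradiction (nonTrivial⇒n>1 1 {{prime⇒nonTrivial p-prime}}) (<-irrefl refl)
  ... | inj₁ (k , refl) with prime⇒irreducible p-prime (divides k (trans (DoubleProperties.double≡2* k) (*-comm 2 k)))
  ...   | inj₁ ()
  ...   | inj₂ 2≡p = contradiction (sym 2≡p) p≢2


open import Data.Nat using (_*_; _%_; _∸_; NonZero)
open import Data.Product using (_×_; _,_)
open import Function using (_⇔_)
import Function.Properties.Equivalence as ⇔
open import Relation.Binary.PropositionalEquality using (_≡_; _≢_; refl)
open Data.Nat.Primality using (Prime)
open Defs using (Wieferich; N; H′; ResidueZero)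

theorem12 : (p : ℕ) → .{{_ : NonZero p}} → Prime p → p ≢ 2 →
    (Wieferich p ⇔ ((2 * N (p ∸ 2)) % p ≡ 1)) × (Wieferich p ⇔ ResidueZero p (H′ p))
theorem12 p p-prime p≢2 with OddPrimes.odd-prime p-prime p≢2
... | m′ , refl = ⇔.trans wieferich⇔H≈0 (⇔.sym 2N%p≡1⇔H≈0) , ⇔.trans wieferich⇔H≈0 (⇔.sym residue⇔H≈0)
  where open WieferichCriteria m′ p-prime
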